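{- Let $L$ be a transitive permutation group on a finite set $\Omega$ admitting a nontrivial block $B$ (that is, a block of imprimitivity with $1<|B|<|\Omega|$). If the pointwise stabiliser $L_{(\Omega\setminus B)}$ of $\Omega\setminus B$ in $L$ is nontrivial, then $L$ has exponential graph growth.
   Context: All groups and graphs are finite; graphs are simple (undirected, no loops or multiple edges). For a graph $\Gamma$, $V\Gamma$ is its vertex set and $\mathrm{Aut}(\Gamma)$ its automorphism group. For $G\le \mathrm{Aut}(\Gamma)$ and $v\in V\Gamma$, $G_v$ denotes the vertex-stabiliser and $G_v^{\Gamma(v)}$ the permutation group induced by $G_v$ on the neighbourhood $\Gamma(v)$ of $v$. If $\Gamma$ is connected, $G$ is transitive on $V\Gamma$, and $G_v^{\Gamma(v)}$ is permutation isomorphic to $L$ (this is independent of $v$), then $(\Gamma,G)$ is called a locally-$L$ pair. A permutation group $L$ has exponential graph growth if there exist a family of locally-$L$ pairs $\{(\Gamma_n,G_n)\}_{n\in\mathbb{N}}$ with $\lim_{n\to\infty}|V\Gamma_n|=\infty$ and a constant $c>1$ such that $|(G_n)_v|\ge c^{|V\Gamma_n|}$ for all $v\in V\Gamma_n$ and all $n\in\mathbb{N}$. For $S\subseteq\Omega$, $L_{(S)}$ denotes the pointwise stabiliser of $S$ in $L$. -}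

module Defs where

open import Data.Nat using (ℕ; zero; suc; _+_; _*_; _^_; _≤_; _<_)
open import Data.Fin using (Fin; _≟_)
open import Data.Fin.Permutation using (Permutation′; _⟨$⟩ʳ_)
open import Data.Fin.Subset using (Subset; _∈_; _∉_; ∣_∣)
open import Data.Bool using (Bool; true; false)
open import Data.List using (List; length; filterᵇ)
open import Data.List.Membership.Propositional using () renaming (_∈_ to _∈ₗ_)
open import Data.List.Relation.Unary.Any using (Any)
open import Data.List.Relation.Unary.AllPairs using (AllPairs)
open import Data.Product using (Σ; ∃; _×_; _,_)
open import Data.Sum using (_⊎_)
open import Relation.Nullary using (¬_; does)
open import Relation.Binary.PropositionalEquality using (_≡_; _≢_)

_≈ₚ_ : ∀ {n} → Permutation′ n → Permutation′ n → Set
_≈ₚ_ {n} g h = ∀ (i : Fin n) → g ⟨$⟩ʳ i ≡ h ⟨$⟩ʳ i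

idₚ-like : ∀ {n} → Permutation′ n → Set
idₚ-like {n} g = ∀ (i : Fin n) → g ⟨$⟩ʳ i ≡ i

record PermGroup (n : ℕ) : Set where
  field
    elems    : List (Permutation′ n)
    distinct : AllPairs (λ g h → ¬ (g ≈ₚ h)) elems
    has-id   : Any idₚ-like elems
    comp     : ∀ g h → g ∈ₗ elems → h ∈ₗ elems →
               Any (λ k → ∀ i → k ⟨$⟩ʳ i ≡ g ⟨$⟩ʳ (h ⟨$⟩ʳ i)) elems
    inv      : ∀ g → g ∈ₗ elems →
               Any (λ k → ∀ i → k ⟨$⟩ʳ (g ⟨$⟩ʳ i) ≡ i) elems
open PermGroup public

Transitive : ∀ {n} → PermGroup n → Set
Transitive {n} G = ∀ (i j : Fin n) → ∃ λ g → g ∈ₗ elems G × g ⟨$⟩ʳ i ≡ j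

-- B is a block of imprimitivity: every g ∈ G maps B onto B or off B
-- (for a permutation, g(B) ⊆ B is equivalent to g(B) = B).
IsBlock : ∀ {n} → PermGroup n → Subset n → Set
IsBlock {n} G B = ∀ g → g ∈ₗ elems G →
  (∀ (x : Fin n) → x ∈ B → (g ⟨$⟩ʳ x) ∈ B) ⊎
  (∀ (x : Fin n) → x ∈ B → (g ⟨$⟩ʳ x) ∉ B)

IsNontrivialBlock : ∀ {n} → PermGroup n → Subset n → Set
IsNontrivialBlock {n} G B = IsBlock G B × 1 < ∣ B ∣ × ∣ B ∣ < n

PtStabComplementNontrivial : ∀ {n} → PermGroup n → Subset n → Set
PtStabComplementNontrivial {n} G B = ∃ λ g → g ∈ₗ elems G ×
  (∀ (x : Fin n) → x ∉ B → g ⟨$⟩ʳ x ≡ x) ×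
  (∃ λ (x : Fin n) → g ⟨$⟩ʳ x ≢ x)

record Graph (N : ℕ) : Set where
  field
    E      : Fin N → Fin N → Bool
    sym    : ∀ u w → E u w ≡ E w u
    irrefl : ∀ u → E u u ≡ false
open Graph public

data Walk {N} (Γ : Graph N) : Fin N → Fin N → Set where
  here : ∀ u → Walk Γ u u
  step : ∀ u v w → E Γ u v ≡ true → Walk Γ v w → Walk Γ u w

Connected : ∀ {N} → Graph N → Set
Connected {N} Γ = ∀ (u w : Fin N) → Walk Γ u w

IsAutomorphism : ∀ {N} → Graph N → Permutation′ N → Set
IsAutomorphism {N} Γ g = ∀ (u w : Fin N) → E Γ (g ⟨$⟩ʳ u) (g ⟨$⟩ʳ w) ≡ E Γ u w

SubgroupOfAut : ∀ {N} → Graph N → PermGroup N → Set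
SubgroupOfAut Γ G = ∀ g → g ∈ₗ elems G → IsAutomorphism Γ g

StabElem : ∀ {N} → PermGroup N → Fin N → Permutation′ N → Set
StabElem G v g = g ∈ₗ elems G × g ⟨$⟩ʳ v ≡ v

stabOrder : ∀ {N} → PermGroup N → Fin N → ℕ
stabOrder G v = length (filterᵇ (λ g → does (g ⟨$⟩ʳ v ≟ v)) (elems G))

-- G_v^{Γ(v)} is permutation isomorphic to L (L on Fin k): there is a
-- bijection φ : Fin k → Γ(v) such that conjugation by φ carries the group
-- induced by G_v on Γ(v) exactly onto L.
LocallyIsoAt : ∀ {N k} → Graph N → PermGroup N → PermGroup k → Fin N → Set
LocallyIsoAt {N} {k} Γ G L v = Σ (Fin k → Fin N) λ φ →
  (∀ i j → φ i ≡ φ j → i ≡ j) ×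
  (∀ i → E Γ v (φ i) ≡ true) ×
  (∀ w → E Γ v w ≡ true → ∃ λ i → φ i ≡ w) ×
  (∀ g → StabElem G v g →
     ∃ λ l → l ∈ₗ elems L × (∀ i → g ⟨$⟩ʳ (φ i) ≡ φ (l ⟨$⟩ʳ i))) ×
  (∀ l → l ∈ₗ elems L →
     ∃ λ g → StabElem G v g × (∀ i → g ⟨$⟩ʳ (φ i) ≡ φ (l ⟨$⟩ʳ i)))

LocallyPair : ∀ {N k} → Graph N → PermGroup N → PermGroup k → Set
LocallyPair {N} Γ G L =
  Connected Γ × SubgroupOfAut Γ G × Transitive G ×
  (∀ (v : Fin N) → LocallyIsoAt Γ G L v)

record LPair {k} (L : PermGroup k) : Set where
  field
    size  : ℕ
    graph : Graph size
    group : PermGroup size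
    isLocally : LocallyPair graph group L
open LPair public

-- Exponential graph growth. The real constant c > 1 is replaced by a
-- rational c = p / q > 1 (equivalent, since Q is dense in R);
-- |G_v| ≥ c^|V| is written q^|V| * |G_v| ≥ p^|V|.
ExponentialGraphGrowth : ∀ {k} → PermGroup k → Set
ExponentialGraphGrowth L =
  Σ (ℕ → LPair L) λ F →
    (∀ M → ∃ λ n₀ → ∀ n → n₀ ≤ n → M ≤ size (F n)) ×
    (∃ λ p → ∃ λ q → 0 < q × q < p ×
      (∀ n (v : Fin (size (F n))) →
        p ^ size (F n) ≤ q ^ size (F n) * stabOrder (group (F n)) v))

module Submission where

-- Let d + 1 ≥ 2 be the number of blocks of L (the translates of B), and κ ∈ L a nontrivial element
-- supported on B.  For each n take the ℤ/(n+1)-homology cover of the complete bipartite graph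
-- K_{d+1,d+1}, whose fibre is Mat = ℤ/(n+1)^{d×d}, and replace each of its vertices, lying over a
-- block c, by the points of c: the vertices are (side , ω , M), and the neighbours of a vertex are
-- labelled by Ω.  Let G be the group of all permutations acting on every neighbourhood like an
-- element of L.  Automorphisms of K_{d+1,d+1} lift to the homology cover, and together with the
-- translations by Mat they make G transitive and locally L.  On the other hand, applying κ or not,
-- independently for each class {(side , ω , M) : ω ∈ B}, is a permutation in G, because the
-- neighbours of a vertex lying in one block share their fibre coordinate.  So a vertex stabiliser
-- has at least 2^|Mat| elements, while the graph has 2k|Mat| vertices.

open import Data.Nat using (ℕ; zero; suc; _*_; s≤s; z≤n)
open import Data.Nat.Properties using (≤-trans; n<1+n)
open import Data.Fin.Subset using (Subset)
open import Data.Product using (_,_)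
open import Defs using (PermGroup; Transitive; IsNontrivialBlock; PtStabComplementNontrivial; ExponentialGraphGrowth)

module AbelianGroups where

  open import Algebra.Bundles using (AbelianGroup)
  open import Algebra.Core using (Op₁; Op₂)
  import Algebra.Properties.AbelianGroup as AbelianGroupProperties
  open import Algebra.Structures using (IsAbelianGroup)
  open import Data.Bool using (if_then_else_)
  open import Data.Fin using (Fin; zero; suc; toℕ; _≟_)
  open import Data.Fin.Properties using (toℕ-fromℕ<; toℕ-injective; toℕ<n)
  open import Data.Nat as ℕ using (ℕ; zero; suc; _%_; _∸_)
  open import Data.Nat.DivMod using (_mod_; %-distribˡ-+; m%n%n≡m%n; m<n⇒m%n≡m; n%n≡0)
  import Data.Nat.Properties as ℕ
  open import Data.Product using (_×_; _,_)
  open import Data.Unit using (⊤; tt)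
  open import Data.Vec using (Vec; []; _∷_; lookup; zipWith; replicate; map)
  open import Data.Vec.Properties using (lookup-replicate)
  open import Level using (0ℓ)
  open import Relation.Nullary using (does)
  open import Relation.Binary.PropositionalEquality

  module _ {A : Set} {_+_ : Op₂ A} {0# : A} { -_ : Op₁ A} where

    ≡-isAbelianGroup : (∀ x y z → (x + y) + z ≡ x + (y + z)) → (∀ x → 0# + x ≡ x) →
                       (∀ x → (- x) + x ≡ 0#) → (∀ x y → x + y ≡ y + x) →
                       IsAbelianGroup _≡_ _+_ 0# -_
    ≡-isAbelianGroup assoc identityˡ inverseˡ comm = record
      { isGroup = record
        { isMonoid = record
          { isSemigroup = record
            { isMagma = record { isEquivalence = isEquivalence ; ∙-cong = cong₂ _+_ }
            ; assoc = assoc }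
          ; identity = identityˡ , λ x → trans (comm x 0#) (identityˡ x) }
        ; inverse = inverseˡ , λ x → trans (comm x (- x)) (inverseˡ x)
        ; ⁻¹-cong = cong -_ }
      ; comm = comm }

  module _ {A : Set} {_+_ : Op₂ A} {0# : A} { -_ : Op₁ A}
           (isAbelianGroup : IsAbelianGroup _≡_ _+_ 0# -_) where

    ≡-abelianGroup : AbelianGroup 0ℓ 0ℓ
    ≡-abelianGroup = record { isAbelianGroup = isAbelianGroup }

    open AbelianGroupProperties ≡-abelianGroup using (identityˡ-unique; inverseˡ-unique)

    module _ (f : A → A) (f-+ : ∀ x y → f (x + y) ≡ f x + f y) where

      additive⇒0 : f 0# ≡ 0#
      additive⇒0 = identityˡ-unique (f 0#) (f 0#)
        (sym (trans (cong f (sym (IsAbelianGroup.identityˡ isAbelianGroup 0#))) (f-+ 0# 0#)))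

      additive⇒- : ∀ x → f (- x) ≡ - f x
      additive⇒- x = inverseˡ-unique (f (- x)) (f x)
        (trans (sym (f-+ (- x) x)) (trans (cong f (IsAbelianGroup.inverseˡ isAbelianGroup x)) additive⇒0))

  -- The family g generates A as a monoid, stated as an induction principle.
  Generates : {A I : Set} → Op₂ A → A → (I → A) → Set₁
  Generates {A} _+_ 0# g = (P : A → Set) → P 0# → (∀ x i → P x → P (x + g i)) → ∀ x → P x

  module ℤmod (n : ℕ) where

    N : ℕ
    N = suc n

    ℤ/N : Set
    ℤ/N = Fin N

    infixl 6 _+_
    infix 8 -_

    0# : ℤ/N
    0# = zero

    opaque
      _+_ : ℤ/N → ℤ/N → ℤ/N
      x + y = (toℕ x ℕ.+ toℕ y) mod N

      -_ : ℤ/N → ℤ/N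
      - x = (N ∸ toℕ x) mod N

      1# : ℤ/N
      1# = 1 mod N

      private
        toℕ-mod : ∀ a → toℕ (a mod N) ≡ a % N
        toℕ-mod a = toℕ-fromℕ< _

        mod-cong : ∀ a b → a % N ≡ b % N → a mod N ≡ b mod N
        mod-cong a b eq = toℕ-injective (trans (toℕ-mod a) (trans eq (sym (toℕ-mod b))))

        %-absorbˡ : ∀ a b → (a % N ℕ.+ b) % N ≡ (a ℕ.+ b) % N
        %-absorbˡ a b = begin
          (a % N ℕ.+ b) % N         ≡⟨ %-distribˡ-+ (a % N) b N ⟩
          (a % N % N ℕ.+ b % N) % N ≡⟨ cong (λ t → (t ℕ.+ b % N) % N) (m%n%n≡m%n a N) ⟩
          (a % N ℕ.+ b % N) % N     ≡⟨ %-distribˡ-+ a b N ⟨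
          (a ℕ.+ b) % N             ∎
          where open ≡-Reasoning

        %-absorbʳ : ∀ a b → (a ℕ.+ b % N) % N ≡ (a ℕ.+ b) % N
        %-absorbʳ a b = begin
          (a ℕ.+ b % N) % N ≡⟨ cong (_% N) (ℕ.+-comm a (b % N)) ⟩
          (b % N ℕ.+ a) % N ≡⟨ %-absorbˡ b a ⟩
          (b ℕ.+ a) % N     ≡⟨ cong (_% N) (ℕ.+-comm b a) ⟩
          (a ℕ.+ b) % N     ∎
          where open ≡-Reasoning

        mod-toℕ : ∀ (x : ℤ/N) → toℕ x mod N ≡ x
        mod-toℕ x = toℕ-injective (trans (toℕ-mod (toℕ x)) (m<n⇒m%n≡m (toℕ<n x)))

      +-assoc : ∀ x y z → (x + y) + z ≡ x + (y + z)
      +-assoc x y z = mod-cong (toℕ (x + y) ℕ.+ toℕ z) (toℕ x ℕ.+ toℕ (y + z)) (begin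
        (toℕ ((toℕ x ℕ.+ toℕ y) mod N) ℕ.+ toℕ z) % N ≡⟨ cong (λ t → (t ℕ.+ toℕ z) % N) (toℕ-mod (toℕ x ℕ.+ toℕ y)) ⟩
        ((toℕ x ℕ.+ toℕ y) % N ℕ.+ toℕ z) % N       ≡⟨ %-absorbˡ (toℕ x ℕ.+ toℕ y) (toℕ z) ⟩
        (toℕ x ℕ.+ toℕ y ℕ.+ toℕ z) % N             ≡⟨ cong (_% N) (ℕ.+-assoc (toℕ x) (toℕ y) (toℕ z)) ⟩
        (toℕ x ℕ.+ (toℕ y ℕ.+ toℕ z)) % N           ≡⟨ %-absorbʳ (toℕ x) (toℕ y ℕ.+ toℕ z) ⟨
        (toℕ x ℕ.+ (toℕ y ℕ.+ toℕ z) % N) % N       ≡⟨ cong (λ t → (toℕ x ℕ.+ t) % N) (toℕ-mod (toℕ y ℕ.+ toℕ z)) ⟨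
        (toℕ x ℕ.+ toℕ ((toℕ y ℕ.+ toℕ z) mod N)) % N ∎)
        where open ≡-Reasoning

      +-identityˡ : ∀ x → 0# + x ≡ x
      +-identityˡ = mod-toℕ

      +-inverseˡ : ∀ x → - x + x ≡ 0#
      +-inverseˡ x = mod-cong (toℕ (- x) ℕ.+ toℕ x) 0 (begin
        (toℕ ((N ∸ toℕ x) mod N) ℕ.+ toℕ x) % N ≡⟨ cong (λ t → (t ℕ.+ toℕ x) % N) (toℕ-mod (N ∸ toℕ x)) ⟩
        ((N ∸ toℕ x) % N ℕ.+ toℕ x) % N       ≡⟨ %-absorbˡ (N ∸ toℕ x) (toℕ x) ⟩
        (N ∸ toℕ x ℕ.+ toℕ x) % N             ≡⟨ cong (_% N) (ℕ.m∸n+n≡m (ℕ.<⇒≤ (toℕ<n x))) ⟩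
        N % N                                 ≡⟨ n%n≡0 N ⟩
        0 % N                                 ∎)
        where open ≡-Reasoning

      +-comm : ∀ x y → x + y ≡ y + x
      +-comm x y = cong (_mod N) (ℕ.+-comm (toℕ x) (toℕ y))

      generates-1 : Generates _+_ 0# (λ (_ : ⊤) → 1#)
      generates-1 P P0 P+1 x = subst P (mod-toℕ x) (P-mod (toℕ x))
        where
        suc-mod : ∀ t → suc t mod N ≡ t mod N + 1#
        suc-mod t = mod-cong (suc t) (toℕ (t mod N) ℕ.+ toℕ 1#) (begin
          suc t % N                                 ≡⟨ cong (_% N) (ℕ.+-comm 1 t) ⟩
          (t ℕ.+ 1) % N                             ≡⟨ %-distribˡ-+ t 1 N ⟩
          (t % N ℕ.+ 1 % N) % N                     ≡⟨ cong₂ (λ a b → (a ℕ.+ b) % N) (toℕ-mod t) (toℕ-mod 1) ⟨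
          (toℕ (t mod N) ℕ.+ toℕ (1 mod N)) % N     ∎)
          where open ≡-Reasoning
        P-mod : ∀ t → P (t mod N)
        P-mod zero = P0
        P-mod (suc t) = subst P (sym (suc-mod t)) (P+1 _ tt (P-mod t))

    isAbelianGroup : IsAbelianGroup _≡_ _+_ 0# -_
    isAbelianGroup = ≡-isAbelianGroup +-assoc +-identityˡ +-inverseˡ +-comm

  module Pointwise {A : Set} {_+ᴬ_ : Op₂ A} {0ᴬ : A} { -ᴬ_ : Op₁ A}
                   (isAbelianGroupᴬ : IsAbelianGroup _≡_ _+ᴬ_ 0ᴬ -ᴬ_) where

    private module A = IsAbelianGroup isAbelianGroupᴬ

    infixl 6 _+_
    infix 8 -_

    _+_ : ∀ {d} → Vec A d → Vec A d → Vec A d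
    _+_ = zipWith _+ᴬ_

    0# : ∀ {d} → Vec A d
    0# = replicate _ 0ᴬ

    -_ : ∀ {d} → Vec A d → Vec A d
    -_ = map -ᴬ_

    isAbelianGroup : ∀ d → IsAbelianGroup _≡_ (_+_ {d}) 0# -_
    isAbelianGroup d = ≡-isAbelianGroup assoc identityˡ inverseˡ comm
      where
      assoc : ∀ {d} (xs ys zs : Vec A d) → (xs + ys) + zs ≡ xs + (ys + zs)
      assoc [] [] [] = refl
      assoc (x ∷ xs) (y ∷ ys) (z ∷ zs) = cong₂ _∷_ (A.assoc x y z) (assoc xs ys zs)
      identityˡ : ∀ {d} (xs : Vec A d) → 0# + xs ≡ xs
      identityˡ [] = refl
      identityˡ (x ∷ xs) = cong₂ _∷_ (A.identityˡ x) (identityˡ xs)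
      inverseˡ : ∀ {d} (xs : Vec A d) → - xs + xs ≡ 0#
      inverseˡ [] = refl
      inverseˡ (x ∷ xs) = cong₂ _∷_ (A.inverseˡ x) (inverseˡ xs)
      comm : ∀ {d} (xs ys : Vec A d) → xs + ys ≡ ys + xs
      comm [] [] = refl
      comm (x ∷ xs) (y ∷ ys) = cong₂ _∷_ (A.comm x y) (comm xs ys)

    single : ∀ {d} → Fin d → A → Vec A d
    single zero x = x ∷ 0#
    single (suc j) x = 0ᴬ ∷ single j x

    lookup-single : ∀ {d} (j : Fin d) x i → lookup (single j x) i ≡ (if does (i ≟ j) then x else 0ᴬ)
    lookup-single zero x zero = refl
    lookup-single zero x (suc i) = lookup-replicate i 0ᴬ
    lookup-single (suc j) x zero = refl
    lookup-single (suc j) x (suc i) = lookup-single j x i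

    single-0 : ∀ {d} (j : Fin d) → single j 0ᴬ ≡ 0#
    single-0 zero = refl
    single-0 (suc j) = cong (0ᴬ ∷_) (single-0 j)

    generates-single : ∀ {I} {g : I → A} → Generates _+ᴬ_ 0ᴬ g →
                       ∀ d → Generates (_+_ {d}) 0# (λ ((j , i) : Fin d × I) → single j (g i))
    generates-single gen zero P P0 step [] = P0
    generates-single {g = g} gen (suc d) P P0 step (x ∷ xs) =
      gen (λ y → P (y ∷ xs)) (P-0∷ xs) step-head x
      where
      P-0∷ : ∀ ys → P (0ᴬ ∷ ys)
      P-0∷ = generates-single gen d (λ ys → P (0ᴬ ∷ ys)) P0
        λ ys (j , i) p → subst (λ a → P (a ∷ ys + single j (g i))) (A.identityˡ 0ᴬ) (step _ (suc j , i) p)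
      step-head : ∀ y i → P (y ∷ xs) → P (y +ᴬ g i ∷ xs)
      step-head y i p =
        subst (λ ys → P (y +ᴬ g i ∷ ys)) (IsAbelianGroup.identityʳ (isAbelianGroup d) xs) (step _ (zero , i) p)

module Vectors where

  open import Data.Fin using (Fin; zero)
  open import Data.Fin.Properties using (*↔×)
  open import Data.Nat using (zero; suc; _^_)
  open import Data.Product using (_×_; _,_; uncurry)
  open import Data.Product.Function.NonDependent.Propositional using (_×-↔_)
  open import Data.Vec using (Vec; []; _∷_; lookup)
  open import Data.Vec.Properties using (tabulate∘lookup; tabulate-cong)
  open import Function.Bundles using (_↔_; mk↔ₛ′)
  open import Function.Properties.Inverse using (↔-trans)
  open import Relation.Binary.PropositionalEquality

  lookup-injective : ∀ {A : Set} {d} {xs ys : Vec A d} → (∀ i → lookup xs i ≡ lookup ys i) → xs ≡ ys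
  lookup-injective {xs = xs} {ys} eq =
    trans (sym (tabulate∘lookup xs)) (trans (tabulate-cong eq) (tabulate∘lookup ys))

  Vec↔ : ∀ {A : Set} {a} → Fin a ↔ A → ∀ d → Fin (a ^ d) ↔ Vec A d
  Vec↔ e zero = mk↔ₛ′ (λ _ → []) (λ _ → zero) (λ { [] → refl }) (λ { zero → refl })
  Vec↔ e (suc d) = ↔-trans *↔× (↔-trans (e ×-↔ Vec↔ e d) ∷↔)
    where
    ∷↔ : ∀ {A : Set} {d} → (A × Vec A d) ↔ Vec A (suc d)
    ∷↔ = mk↔ₛ′ (uncurry _∷_) (λ { (x ∷ xs) → x , xs }) (λ { (x ∷ xs) → refl }) (λ _ → refl)

module Homology (n d : ℕ) where

  open import Algebra.Bundles using (CommutativeMonoid)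
  open import Level using (0ℓ)
  open import Algebra.Structures using (IsAbelianGroup)
  import Algebra.Properties.AbelianGroup as AbelianGroupProperties
  import Algebra.Properties.CommutativeMonoid.Sum as Sum
  open import Data.Bool using (Bool; true; false; if_then_else_; _∧_)
  open import Data.Bool.Properties using (∧-comm)
  open import Data.Empty using (⊥-elim)
  open import Data.Fin using (Fin; zero; suc; _≟_)
  open import Data.Fin.Permutation using (Permutation′; _⟨$⟩ʳ_; _⟨$⟩ˡ_; inverseˡ; inverseʳ; flip)
  open import Data.Nat using (zero; suc)
  open import Data.Product using (_×_; _,_)
  open import Data.Unit using (⊤)
  open import Data.Vec using (Vec; lookup; map; tabulate)
  open import Data.Vec.Properties using (lookup∘tabulate; lookup-map; lookup-zipWith; lookup-replicate)
  open import Relation.Nullary using (does; yes; no)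
  open import Relation.Binary.PropositionalEquality
  open import Function using (_∘_)
  open AbelianGroups using (module ℤmod; module Pointwise; ≡-abelianGroup; additive⇒0; additive⇒-; Generates)
  open Vectors using (lookup-injective)


  private
    module ℤ = ℤmod n
    module ℤ-laws = IsAbelianGroup ℤ.isAbelianGroup
    module ℤ-props = AbelianGroupProperties (≡-abelianGroup ℤ.isAbelianGroup)
    module R = Pointwise ℤ.isAbelianGroup
    module M = Pointwise (R.isAbelianGroup d)
    ℤ-commutativeMonoid : CommutativeMonoid 0ℓ 0ℓ
    ℤ-commutativeMonoid = record { isCommutativeMonoid = IsAbelianGroup.isCommutativeMonoid ℤ.isAbelianGroup }
    open Sum ℤ-commutativeMonoid using (sum; ∑-distrib-+; sum-permute; sum-cong-≗)

  open ℤ using (ℤ/N)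

  Row Mat : Set
  Row = Vec ℤ/N d
  Mat = Vec Row d

  open M public using (_+_; 0#; -_)

  isAbelianGroup : IsAbelianGroup _≡_ (_+_ {d}) 0# -_
  isAbelianGroup = M.isAbelianGroup d

  open IsAbelianGroup isAbelianGroup public using (_-_)

  entry : Mat → Fin d → Fin d → ℤ/N
  entry X i j = lookup (lookup X i) j

  entry-injective : ∀ {X Y} → (∀ i j → entry X i j ≡ entry Y i j) → X ≡ Y
  entry-injective eq = lookup-injective λ i → lookup-injective (eq i)

  δ : Fin (suc d) → Fin (suc d) → ℤ/N
  δ a b = if does (a ≟ b) then ℤ.1# else ℤ.0#

  u : Fin (suc d) → Row
  u zero = R.0#
  u (suc j) = R.single j ℤ.1#

  -- Mat is H₁(K_{d+1,d+1}; ℤ/N), rows and columns indexing the blocks ≠ 0 of the two sides: the edges at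
  -- block 0 form a spanning tree and get voltage 0, and the edge between blocks suc i and suc j is the
  -- (i , j) coordinate.
  voltage : Fin (suc d) → Fin (suc d) → Mat
  voltage zero c' = 0#
  voltage (suc i) c' = M.single i (u c')

  lookup-u : ∀ c j → lookup (u c) j ≡ δ (suc j) c
  lookup-u zero j = lookup-replicate j ℤ.0#
  lookup-u (suc j₀) j = R.lookup-single j₀ ℤ.1# j

  lookup-voltage : ∀ c c' i → lookup (voltage c c') i ≡ (if does (suc i ≟ c) then u c' else R.0#)
  lookup-voltage zero c' i = lookup-replicate i R.0#
  lookup-voltage (suc i₀) c' i = M.lookup-single i₀ (u c') i

  voltage-entry : ∀ c c' i j → entry (voltage c c') i j ≡ (if does (suc i ≟ c) ∧ does (suc j ≟ c') then ℤ.1# else ℤ.0#)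
  voltage-entry c c' i j rewrite lookup-voltage c c' i with does (suc i ≟ c)
  ... | true = lookup-u c' j
  ... | false = lookup-replicate j ℤ.0#

  voltage-zeroʳ : ∀ c → voltage c zero ≡ 0#
  voltage-zeroʳ zero = refl
  voltage-zeroʳ (suc i) = M.single-0 i

  generates-voltage : Generates _+_ 0# (λ ((i , j , _) : Fin d × Fin d × ⊤) → voltage (suc i) (suc j))
  generates-voltage = M.generates-single (R.generates-single ℤ.generates-1 d) d

  entry-+ : ∀ X Y i j → entry (X + Y) i j ≡ entry X i j ℤ.+ entry Y i j
  entry-+ X Y i j =
    trans (cong (λ r → lookup r j) (lookup-zipWith R._+_ i X Y)) (lookup-zipWith ℤ._+_ j (lookup X i) (lookup Y i))

  entry-neg : ∀ X i j → entry (- X) i j ≡ ℤ.- entry X i j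
  entry-neg X i j = trans (cong (λ r → lookup r j) (lookup-map i R.-_ X)) (lookup-map j ℤ.-_ (lookup X i))

  -- The action on H₁ of exchanging the two sides of K_{d+1,d+1}.
  transposeNeg : Mat → Mat
  transposeNeg X = tabulate λ i → tabulate λ j → ℤ.- entry X j i

  entry-transposeNeg : ∀ X i j → entry (transposeNeg X) i j ≡ ℤ.- entry X j i
  entry-transposeNeg X i j =
    trans (cong (λ r → lookup r j) (lookup∘tabulate _ i)) (lookup∘tabulate _ j)

  transposeNeg-+ : ∀ X Y → transposeNeg (X + Y) ≡ transposeNeg X + transposeNeg Y
  transposeNeg-+ X Y = entry-injective λ i j → begin
    entry (transposeNeg (X + Y)) i j              ≡⟨ entry-transposeNeg (X + Y) i j ⟩
    ℤ.- entry (X + Y) j i                         ≡⟨ cong ℤ.-_ (entry-+ X Y j i) ⟩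
    ℤ.- (entry X j i ℤ.+ entry Y j i)             ≡⟨ ℤ-props.⁻¹-∙-comm (entry X j i) (entry Y j i) ⟨
    ℤ.- entry X j i ℤ.+ ℤ.- entry Y j i           ≡⟨ cong₂ ℤ._+_ (entry-transposeNeg X i j) (entry-transposeNeg Y i j) ⟨
    entry (transposeNeg X) i j ℤ.+ entry (transposeNeg Y) i j ≡⟨ entry-+ (transposeNeg X) (transposeNeg Y) i j ⟨
    entry (transposeNeg X + transposeNeg Y) i j   ∎
    where open ≡-Reasoning

  transposeNeg-involutive : ∀ X → transposeNeg (transposeNeg X) ≡ X
  transposeNeg-involutive X = entry-injective λ i j →
    trans (entry-transposeNeg (transposeNeg X) i j)
          (trans (cong ℤ.-_ (entry-transposeNeg X j i)) (ℤ-props.⁻¹-involutive (entry X i j)))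

  transposeNeg-voltage : ∀ c c' → transposeNeg (voltage c c') ≡ - voltage c' c
  transposeNeg-voltage c c' = entry-injective λ i j → begin
    entry (transposeNeg (voltage c c')) i j ≡⟨ entry-transposeNeg (voltage c c') i j ⟩
    ℤ.- entry (voltage c c') j i            ≡⟨ cong ℤ.-_ (voltage-entry c c' j i) ⟩
    ℤ.- (if does (suc j ≟ c) ∧ does (suc i ≟ c') then ℤ.1# else ℤ.0#)
      ≡⟨ cong (λ b → ℤ.- (if b then ℤ.1# else ℤ.0#)) (∧-comm (does (suc j ≟ c)) _) ⟩
    ℤ.- (if does (suc i ≟ c') ∧ does (suc j ≟ c) then ℤ.1# else ℤ.0#)
      ≡⟨ cong ℤ.-_ (voltage-entry c' c i j) ⟨
    ℤ.- entry (voltage c' c) i j            ≡⟨ entry-neg (voltage c' c) i j ⟨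
    entry (- voltage c' c) i j              ∎
    where open ≡-Reasoning

  private
    x-0≡x : ∀ x → x ℤ.+ ℤ.- ℤ.0# ≡ x
    x-0≡x x = trans (cong (x ℤ.+_) ℤ-props.ε⁻¹≈ε) (ℤ-laws.identityʳ x)

    sum-0 : ∀ {e} → sum (lookup (R.0# {e})) ≡ ℤ.0#
    sum-0 {zero} = refl
    sum-0 {suc e} = trans (ℤ-laws.identityˡ _) (sum-0 {e})

    sum-single : ∀ {e} (j : Fin e) x → sum (lookup (R.single j x)) ≡ x
    sum-single {suc e} zero x = trans (cong (x ℤ.+_) (sum-0 {e})) (ℤ-laws.identityʳ x)
    sum-single (suc j) x = trans (ℤ-laws.identityˡ _) (sum-single j x)

  -- A row in reduced coordinates, as the zero-sum function on all blocks it stands for.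
  extend : Row → Fin (suc d) → ℤ/N
  extend x zero = ℤ.- sum (lookup x)
  extend x (suc j) = lookup x j

  permuteRow : Permutation′ (suc d) → Row → Row
  permuteRow π x = tabulate λ j → extend x (π ⟨$⟩ˡ suc j)

  -- The action on H₁ of permuting the blocks of the second side by π.
  permuteColumns : Permutation′ (suc d) → Mat → Mat
  permuteColumns π = map (permuteRow π)

  sum-extend : ∀ x → sum (extend x) ≡ ℤ.0#
  sum-extend x = ℤ-laws.inverseˡ (sum (lookup x))

  extend-+ : ∀ x y k → extend (x R.+ y) k ≡ extend x k ℤ.+ extend y k
  extend-+ x y zero = begin
    ℤ.- sum (lookup (x R.+ y))                    ≡⟨ cong ℤ.-_ (sum-cong-≗ (λ j → lookup-zipWith ℤ._+_ j x y)) ⟩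
    ℤ.- sum (λ j → lookup x j ℤ.+ lookup y j)     ≡⟨ cong ℤ.-_ (∑-distrib-+ (lookup x) (lookup y)) ⟩
    ℤ.- (sum (lookup x) ℤ.+ sum (lookup y))       ≡⟨ ℤ-props.⁻¹-∙-comm (sum (lookup x)) (sum (lookup y)) ⟨
    ℤ.- sum (lookup x) ℤ.+ ℤ.- sum (lookup y)     ∎
    where open ≡-Reasoning
  extend-+ x y (suc j) = lookup-zipWith ℤ._+_ j x y

  permuteRow-+ : ∀ π x y → permuteRow π (x R.+ y) ≡ permuteRow π x R.+ permuteRow π y
  permuteRow-+ π x y = lookup-injective λ j → begin
    lookup (permuteRow π (x R.+ y)) j                   ≡⟨ lookup∘tabulate _ j ⟩
    extend (x R.+ y) (π ⟨$⟩ˡ suc j)                     ≡⟨ extend-+ x y (π ⟨$⟩ˡ suc j) ⟩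
    extend x (π ⟨$⟩ˡ suc j) ℤ.+ extend y (π ⟨$⟩ˡ suc j) ≡⟨ cong₂ ℤ._+_ (lookup∘tabulate _ j) (lookup∘tabulate _ j) ⟨
    lookup (permuteRow π x) j ℤ.+ lookup (permuteRow π y) j ≡⟨ lookup-zipWith ℤ._+_ j (permuteRow π x) (permuteRow π y) ⟨
    lookup (permuteRow π x R.+ permuteRow π y) j        ∎
    where open ≡-Reasoning

  permuteColumns-+ : ∀ π X Y → permuteColumns π (X + Y) ≡ permuteColumns π X + permuteColumns π Y
  permuteColumns-+ π X Y = lookup-injective λ i → begin
    lookup (permuteColumns π (X + Y)) i
      ≡⟨ lookup-map i (permuteRow π) (X + Y) ⟩
    permuteRow π (lookup (X + Y) i)
      ≡⟨ cong (permuteRow π) (lookup-zipWith R._+_ i X Y) ⟩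
    permuteRow π (lookup X i R.+ lookup Y i)
      ≡⟨ permuteRow-+ π (lookup X i) (lookup Y i) ⟩
    permuteRow π (lookup X i) R.+ permuteRow π (lookup Y i)
      ≡⟨ cong₂ R._+_ (lookup-map i (permuteRow π) X) (lookup-map i (permuteRow π) Y) ⟨
    lookup (permuteColumns π X) i R.+ lookup (permuteColumns π Y) i
      ≡⟨ lookup-zipWith R._+_ i (permuteColumns π X) (permuteColumns π Y) ⟨
    lookup (permuteColumns π X + permuteColumns π Y) i ∎
    where open ≡-Reasoning

  permuteColumns-0 : ∀ π → permuteColumns π 0# ≡ 0#
  permuteColumns-0 π = additive⇒0 isAbelianGroup (permuteColumns π) (permuteColumns-+ π)

  permuteColumns-neg : ∀ π X → permuteColumns π (- X) ≡ - permuteColumns π X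
  permuteColumns-neg π = additive⇒- isAbelianGroup (permuteColumns π) (permuteColumns-+ π)

  extend-u : ∀ c k → extend (u c) k ≡ δ k c ℤ.+ ℤ.- δ k zero
  extend-u c (suc j) = trans (lookup-u c j) (sym (x-0≡x (δ (suc j) c)))
  extend-u zero zero = trans (cong ℤ.-_ (sum-0 {d})) (trans ℤ-props.ε⁻¹≈ε (sym (ℤ-laws.inverseʳ ℤ.1#)))
  extend-u (suc j₀) zero = trans (cong ℤ.-_ (sum-single j₀ ℤ.1#)) (sym (ℤ-laws.identityˡ _))

  δ-permute : ∀ (π : Permutation′ (suc d)) a b → δ (π ⟨$⟩ˡ a) b ≡ δ a (π ⟨$⟩ʳ b)
  δ-permute π a b with π ⟨$⟩ˡ a ≟ b | a ≟ π ⟨$⟩ʳ b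
  ... | yes _ | yes _ = refl
  ... | no _ | no _ = refl
  ... | yes p | no ¬q = ⊥-elim (¬q (trans (sym (inverseʳ π)) (cong (π ⟨$⟩ʳ_) p)))
  ... | no ¬p | yes q = ⊥-elim (¬p (trans (cong (π ⟨$⟩ˡ_) q) (inverseˡ π)))

  permuteRow-u : ∀ π c → permuteRow π (u c) ≡ u (π ⟨$⟩ʳ c) R.+ R.- u (π ⟨$⟩ʳ zero)
  permuteRow-u π c = lookup-injective λ j → begin
    lookup (permuteRow π (u c)) j
      ≡⟨ lookup∘tabulate _ j ⟩
    extend (u c) (π ⟨$⟩ˡ suc j)
      ≡⟨ extend-u c (π ⟨$⟩ˡ suc j) ⟩
    δ (π ⟨$⟩ˡ suc j) c ℤ.+ ℤ.- δ (π ⟨$⟩ˡ suc j) zero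
      ≡⟨ cong₂ (λ a b → a ℤ.+ ℤ.- b) (δ-permute π (suc j) c) (δ-permute π (suc j) zero) ⟩
    δ (suc j) (π ⟨$⟩ʳ c) ℤ.+ ℤ.- δ (suc j) (π ⟨$⟩ʳ zero)
      ≡⟨ cong₂ (λ a b → a ℤ.+ ℤ.- b) (lookup-u (π ⟨$⟩ʳ c) j) (lookup-u (π ⟨$⟩ʳ zero) j) ⟨
    lookup (u (π ⟨$⟩ʳ c)) j ℤ.+ ℤ.- lookup (u (π ⟨$⟩ʳ zero)) j
      ≡⟨ cong (lookup (u (π ⟨$⟩ʳ c)) j ℤ.+_) (lookup-map j ℤ.-_ (u (π ⟨$⟩ʳ zero))) ⟨
    lookup (u (π ⟨$⟩ʳ c)) j ℤ.+ lookup (R.- u (π ⟨$⟩ʳ zero)) j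
      ≡⟨ lookup-zipWith ℤ._+_ j (u (π ⟨$⟩ʳ c)) (R.- u (π ⟨$⟩ʳ zero)) ⟨
    lookup (u (π ⟨$⟩ʳ c) R.+ R.- u (π ⟨$⟩ʳ zero)) j ∎
    where open ≡-Reasoning

  permuteColumns-voltage : ∀ π c c' →
    permuteColumns π (voltage c c') ≡ voltage c (π ⟨$⟩ʳ c') - voltage c (π ⟨$⟩ʳ zero)
  permuteColumns-voltage π c c' = lookup-injective λ i → begin
    lookup (permuteColumns π (voltage c c')) i   ≡⟨ lookup-map i (permuteRow π) (voltage c c') ⟩
    permuteRow π (lookup (voltage c c') i)       ≡⟨ cong (permuteRow π) (lookup-voltage c c' i) ⟩
    permuteRow π (if does (suc i ≟ c) then u c' else R.0#)
      ≡⟨ on-row (does (suc i ≟ c)) ⟩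
    (if does (suc i ≟ c) then u (π ⟨$⟩ʳ c') else R.0#) R.+ R.- (if does (suc i ≟ c) then u (π ⟨$⟩ʳ zero) else R.0#)
      ≡⟨ cong₂ (λ r s → r R.+ R.- s) (lookup-voltage c _ i) (lookup-voltage c _ i) ⟨
    lookup (voltage c (π ⟨$⟩ʳ c')) i R.+ R.- lookup (voltage c (π ⟨$⟩ʳ zero)) i
      ≡⟨ cong (lookup (voltage c (π ⟨$⟩ʳ c')) i R.+_) (lookup-map i R.-_ (voltage c (π ⟨$⟩ʳ zero))) ⟨
    lookup (voltage c (π ⟨$⟩ʳ c')) i R.+ lookup (- voltage c (π ⟨$⟩ʳ zero)) i
      ≡⟨ lookup-zipWith R._+_ i (voltage c (π ⟨$⟩ʳ c')) (- voltage c (π ⟨$⟩ʳ zero)) ⟨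
    lookup (voltage c (π ⟨$⟩ʳ c') - voltage c (π ⟨$⟩ʳ zero)) i ∎
    where
    open ≡-Reasoning
    on-row : ∀ b → permuteRow π (if b then u c' else R.0#) ≡
                   (if b then u (π ⟨$⟩ʳ c') else R.0#) R.+ R.- (if b then u (π ⟨$⟩ʳ zero) else R.0#)
    on-row true = permuteRow-u π c'
    on-row false = trans (additive⇒0 (R.isAbelianGroup d) (permuteRow π) (permuteRow-+ π))
                         (sym (IsAbelianGroup.inverseʳ (R.isAbelianGroup d) R.0#))

  extend-permuteRow : ∀ π x k → extend (permuteRow π x) k ≡ extend x (π ⟨$⟩ˡ k)
  extend-permuteRow π x (suc j) = lookup∘tabulate _ j
  extend-permuteRow π x zero =
    trans (cong ℤ.-_ (sum-cong-≗ (lookup∘tabulate (g ∘ suc))))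
          (sym (ℤ-props.inverseˡ-unique (g zero) (sum (g ∘ suc)) g-sums-to-0))
    where
    g : Fin (suc d) → ℤ/N
    g k = extend x (π ⟨$⟩ˡ k)
    g-sums-to-0 : g zero ℤ.+ sum (g ∘ suc) ≡ ℤ.0#
    g-sums-to-0 = trans (sym (sum-permute (extend x) (flip π))) (sum-extend x)

  permuteColumns-inverseˡ : ∀ π X → permuteColumns (flip π) (permuteColumns π X) ≡ X
  permuteColumns-inverseˡ π X = lookup-injective λ i → begin
    lookup (permuteColumns (flip π) (permuteColumns π X)) i ≡⟨ lookup-map i _ (permuteColumns π X) ⟩
    permuteRow (flip π) (lookup (permuteColumns π X) i)     ≡⟨ cong (permuteRow (flip π)) (lookup-map i _ X) ⟩
    permuteRow (flip π) (permuteRow π (lookup X i))         ≡⟨ lookup-injective (row-inverse (lookup X i)) ⟩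
    lookup X i                                              ∎
    where
    open ≡-Reasoning
    row-inverse : ∀ x j → lookup (permuteRow (flip π) (permuteRow π x)) j ≡ lookup x j
    row-inverse x j = begin
      lookup (permuteRow (flip π) (permuteRow π x)) j ≡⟨ lookup∘tabulate _ j ⟩
      extend (permuteRow π x) (π ⟨$⟩ʳ suc j)          ≡⟨ extend-permuteRow π x (π ⟨$⟩ʳ suc j) ⟩
      extend x (π ⟨$⟩ˡ (π ⟨$⟩ʳ suc j))                ≡⟨ cong (extend x) (inverseˡ π) ⟩
      lookup x j                                      ∎

  permuteColumns-inverseʳ : ∀ π X → permuteColumns π (permuteColumns (flip π) X) ≡ X
  permuteColumns-inverseʳ π = permuteColumns-inverseˡ (flip π)

module PermutationGroups where

  open import Data.Bool.Properties using (T-≡)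
  open import Data.Fin using (Fin; _≟_)
  open import Data.Fin.Permutation using (Permutation′; _⟨$⟩ʳ_; _⟨$⟩ˡ_; inverseˡ; inverseʳ)
  open import Data.Fin.Properties using (injective⇒≤)
  open import Data.List as List using (filterᵇ)
  open import Data.List.Membership.Propositional using (find) renaming (_∈_ to _∈ₗ_)
  open import Data.List.Membership.Propositional.Properties using (∈-filter⁺)
  open import Data.List.Relation.Unary.Any as Any using ()
  open import Data.List.Relation.Unary.Any.Properties using (lookup-index)
  open import Data.Nat using (_≤_)
  open import Data.Product using (∃; _×_; _,_; proj₁; proj₂)
  open import Function using (id; _∘_)
  open import Function.Bundles using (Equivalence)
  open import Relation.Binary.PropositionalEquality
  open import Relation.Nullary using (does)
  open import Relation.Nullary.Decidable using (dec-true; T?)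
  open import Defs using (PermGroup; elems; has-id; comp; inv; Transitive; StabElem; stabOrder)

  module _ {n} (G : PermGroup n) where

    IsElement : (Fin n → Fin n) → Set
    IsElement f = ∃ λ g → g ∈ₗ elems G × (∀ i → g ⟨$⟩ʳ i ≡ f i)

    id-element : IsElement id
    id-element = find (has-id G)

    ∘-element : ∀ {f h} → IsElement f → IsElement h → IsElement (f ∘ h)
    ∘-element {f} {h} (g , g∈ , g≗f) (g' , g'∈ , g'≗h) =
      let (c , c∈ , c≗gg') = find (comp G g g' g∈ g'∈) in
      c , c∈ , λ i → trans (c≗gg' i) (trans (cong (g ⟨$⟩ʳ_) (g'≗h i)) (g≗f (h i)))

    inverse-element : ∀ {g} → g ∈ₗ elems G → IsElement (g ⟨$⟩ˡ_)
    inverse-element {g} g∈ =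
      let (c , c∈ , c-inv) = find (inv G g g∈) in
      c , c∈ , λ i → trans (cong (c ⟨$⟩ʳ_) (sym (inverseʳ g))) (c-inv (g ⟨$⟩ˡ i))

    transitive-from : ∀ z₀ → (∀ z → ∃ λ g → g ∈ₗ elems G × g ⟨$⟩ʳ z₀ ≡ z) → Transitive G
    transitive-from z₀ reach i j =
      let (gᵢ , gᵢ∈ , gᵢz₀≡i) = reach i
          (gⱼ , gⱼ∈ , gⱼz₀≡j) = reach j
          (c , c∈ , c≗gⱼgᵢ⁻¹) = ∘-element (gⱼ , gⱼ∈ , λ _ → refl) (inverse-element gᵢ∈) in
      c , c∈ , trans (c≗gⱼgᵢ⁻¹ i) (trans (cong (gⱼ ⟨$⟩ʳ_) (trans (cong (gᵢ ⟨$⟩ˡ_) (sym gᵢz₀≡i)) (inverseˡ gᵢ))) gⱼz₀≡j)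

    stabOrder-≥ : ∀ z {a} (f : Fin a → Permutation′ n) → (∀ i → StabElem G z (f i)) →
                  (∀ i j → f i ≡ f j → i ≡ j) → a ≤ stabOrder G z
    stabOrder-≥ z f f-stab f-injective = injective⇒≤ {f = Any.index ∘ f∈} λ {i} {j} eq →
      f-injective i j (trans (lookup-index (f∈ i)) (trans (cong (List.lookup stabiliser) eq) (sym (lookup-index (f∈ j)))))
      where
      stabiliser = filterᵇ (λ g → does (g ⟨$⟩ʳ z ≟ z)) (elems G)
      f∈ : ∀ i → f i ∈ₗ stabiliser
      f∈ i = ∈-filter⁺ (λ g → T? (does (g ⟨$⟩ʳ z ≟ z))) (proj₁ (f-stab i))
                       (Equivalence.from T-≡ (dec-true (f i ⟨$⟩ʳ z ≟ z) (proj₂ (f-stab i))))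

module Blocks where

  open import Data.Bool using (Bool; true) renaming (_≟_ to _≟ᵇ_)
  open import Data.Empty using (⊥-elim)
  open import Data.Fin using (Fin; zero; suc; _≟_)
  open import Data.Fin.Permutation using (Permutation′; _⟨$⟩ʳ_; _⟨$⟩ˡ_; inverseˡ; inverseʳ; permutation)
  open import Data.Fin.Properties using (any?; suc-injective)
  open import Data.Fin.Subset using (Subset; _∈_; _∉_; ∣_∣; ⊤)
  open import Data.Fin.Subset.Properties using (_∈?_; ∣⊤∣≡n; p⊆q⇒∣p∣≤∣q∣)
  open import Data.List.Membership.Propositional using () renaming (_∈_ to _∈ₗ_)
  open import Data.List.Relation.Unary.All as All using (All; all?)
  open import Data.Nat using (ℕ; zero; suc; _≤_; _<_; s≤s; z≤n)
  import Data.Nat.Properties as ℕ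
  open import Data.Product using (∃; _,_; proj₁; proj₂)
  open import Data.Sum using (_⊎_; inj₁; inj₂)
  open import Function using (_∘_)
  open import Level using (0ℓ)
  open import Relation.Binary using (Rel; IsDecEquivalence)
  import Relation.Binary.Construct.On as On
  open import Relation.Binary.PropositionalEquality
  open import Relation.Nullary using (yes; no; does; ¬_; ¬?)
  open import Relation.Nullary.Decidable using (dec-true; dec-false; decidable-stable)
  open import Defs using (PermGroup; elems; IsBlock; IsNontrivialBlock; PtStabComplementNontrivial)
  open PermutationGroups using (∘-element; id-element; inverse-element)

  record Quotient {k} (_~_ : Rel (Fin k) 0ℓ) (m : ℕ) : Set where
    field
      class : Fin k → Fin m
      rep : Fin m → Fin k
      class-rep : ∀ c → class (rep c) ≡ c
      class-≡⇒~ : ∀ {x y} → class x ≡ class y → x ~ y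
      ~⇒class-≡ : ∀ {x y} → x ~ y → class x ≡ class y

  quotient : ∀ {k} {_~_ : Rel (Fin k) 0ℓ} → IsDecEquivalence _~_ → ∃ (Quotient _~_)
  quotient {zero} _ = 0 , record
    { class = λ () ; rep = λ () ; class-rep = λ () ; class-≡⇒~ = λ { {()} } ; ~⇒class-≡ = λ { {()} } }
  quotient {suc k} {_~_} isDecEq with quotient (On.isDecEquivalence suc isDecEq) | any? (λ y → zero ≟~ suc y)
    where open IsDecEquivalence isDecEq renaming (_≟_ to _≟~_)
  ... | m , Q | yes (y , 0~y) = m , record
    { class = λ { zero → class y ; (suc x) → class x }
    ; rep = suc ∘ rep
    ; class-rep = class-rep
    ; class-≡⇒~ = λ { {zero} {zero} _ → refl′ ; {zero} {suc x} e → trans′ 0~y (class-≡⇒~ e)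
                    ; {suc x} {zero} e → sym′ (trans′ 0~y (class-≡⇒~ (sym e))) ; {suc x} {suc x'} e → class-≡⇒~ e }
    ; ~⇒class-≡ = λ { {zero} {zero} _ → refl ; {zero} {suc x} e → ~⇒class-≡ (trans′ (sym′ 0~y) e)
                    ; {suc x} {zero} e → sym (~⇒class-≡ (trans′ (sym′ 0~y) (sym′ e))) ; {suc x} {suc x'} e → ~⇒class-≡ e } }
    where
    open Quotient Q
    open IsDecEquivalence isDecEq renaming (refl to refl′; sym to sym′; trans to trans′)
  ... | m , Q | no ¬0~ = suc m , record
    { class = λ { zero → zero ; (suc x) → suc (class x) }
    ; rep = λ { zero → zero ; (suc c) → suc (rep c) }
    ; class-rep = λ { zero → refl ; (suc c) → cong suc (class-rep c) }
    ; class-≡⇒~ = λ { {zero} {zero} _ → refl′ ; {suc x} {suc x'} e → class-≡⇒~ (suc-injective e) }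
    ; ~⇒class-≡ = λ { {zero} {zero} _ → refl ; {zero} {suc x} e → ⊥-elim (¬0~ (x , e))
                    ; {suc x} {zero} e → ⊥-elim (¬0~ (x , sym′ e)) ; {suc x} {suc x'} e → cong suc (~⇒class-≡ e) } }
    where
    open Quotient Q
    open IsDecEquivalence isDecEq renaming (refl to refl′; sym to sym′)

  record BlockSystem {k} (L : PermGroup k) : Set where
    field
      d : ℕ
      1≤d : 1 ≤ d
      block : Fin k → Fin (suc d)
      rep : Fin (suc d) → Fin k
      block-rep : ∀ c → block (rep c) ≡ c
      action : ∀ l → l ∈ₗ elems L → Permutation′ (suc d)
      block-action : ∀ l (l∈ : l ∈ₗ elems L) x → block (l ⟨$⟩ʳ x) ≡ action l l∈ ⟨$⟩ʳ block x
      κ : Permutation′ k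
      κ∈L : κ ∈ₗ elems L
      κ-block : Fin (suc d)
      κ-fixes : ∀ x → block x ≢ κ-block → κ ⟨$⟩ʳ x ≡ x
      κ-moves : ∃ λ x → κ ⟨$⟩ʳ x ≢ x

    block-κ : ∀ x → block (κ ⟨$⟩ʳ x) ≡ block x
    block-κ x with block x ≟ κ-block | block (κ ⟨$⟩ʳ x) ≟ κ-block
    ... | no x∉ | _ = cong block (κ-fixes x x∉)
    ... | yes x∈ | yes κx∈ = trans κx∈ (sym x∈)
    ... | yes x∈ | no κx∉ = ⊥-elim (κx∉ (subst (λ y → block y ≡ κ-block) (sym κx≡x) x∈))
      where
      κx≡x : κ ⟨$⟩ʳ x ≡ x
      κx≡x = trans (sym (inverseˡ κ)) (trans (cong (κ ⟨$⟩ˡ_) (κ-fixes _ κx∉)) (inverseˡ κ))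

  module _ {k} (L : PermGroup k) (B : Subset k) where

    private
      inB : Fin k → Bool
      inB x = does (x ∈? B)

    -- No translate of B separates x from y; for a block B this says x and y lie in a common translate.
    Unseparated : Rel (Fin k) 0ℓ
    Unseparated x y = All (λ l → inB (l ⟨$⟩ʳ x) ≡ inB (l ⟨$⟩ʳ y)) (elems L)

    unseparated-isDecEquivalence : IsDecEquivalence Unseparated
    unseparated-isDecEquivalence = record
      { isEquivalence = record
        { refl = All.tabulate λ _ → refl
        ; sym = All.map sym
        ; trans = λ p q → All.zipWith (λ (a , b) → trans a b) (p , q) }
      ; _≟_ = λ x y → all? (λ l → inB (l ⟨$⟩ʳ x) ≟ᵇ inB (l ⟨$⟩ʳ y)) (elems L) }

    unseparated-respects : ∀ {g} → g ∈ₗ elems L → ∀ {x y} → Unseparated x y → Unseparated (g ⟨$⟩ʳ x) (g ⟨$⟩ʳ y)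
    unseparated-respects {g} g∈ {x} {y} x~y = All.tabulate λ {l} l∈ →
      let (c , c∈ , c≗lg) = ∘-element L (l , l∈ , λ _ → refl) (g , g∈ , λ _ → refl) in
      trans (cong inB (sym (c≗lg x))) (trans (All.lookup x~y c∈) (cong inB (c≗lg y)))

    unseparated-∈ : ∀ {x y} → Unseparated x y → x ∈ B → y ∈ B
    unseparated-∈ {x} {y} x~y x∈B =
      let (e , e∈ , e≗id) = id-element L in
      dec-true⁻¹ (trans (cong inB (sym (e≗id y)))
                   (trans (sym (All.lookup x~y e∈)) (trans (cong inB (e≗id x)) (dec-true (x ∈? B) x∈B))))
      where
      dec-true⁻¹ : ∀ {z} → inB z ≡ true → z ∈ B
      dec-true⁻¹ {z} eq with z ∈? B
      ... | yes z∈B = z∈B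

    ∈-unseparated : IsBlock L B → ∀ {x y} → x ∈ B → y ∈ B → Unseparated x y
    ∈-unseparated isBlock {x} {y} x∈B y∈B = All.tabulate λ {l} l∈ → same-side l (isBlock l l∈)
      where
      same-side : ∀ l → (∀ z → z ∈ B → l ⟨$⟩ʳ z ∈ B) ⊎ (∀ z → z ∈ B → l ⟨$⟩ʳ z ∉ B) → inB (l ⟨$⟩ʳ x) ≡ inB (l ⟨$⟩ʳ y)
      same-side l (inj₁ maps-in) =
        trans (dec-true (l ⟨$⟩ʳ x ∈? B) (maps-in x x∈B)) (sym (dec-true (l ⟨$⟩ʳ y ∈? B) (maps-in y y∈B)))
      same-side l (inj₂ maps-out) =
        trans (dec-false (l ⟨$⟩ʳ x ∈? B) (maps-out x x∈B)) (sym (dec-false (l ⟨$⟩ʳ y ∈? B) (maps-out y y∈B)))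

    private
      point-outside : ∣ B ∣ < k → ∃ λ w → w ∉ B
      point-outside |B|<k with any? (λ w → ¬? (w ∈? B))
      ... | yes w∉B = w∉B
      ... | no ¬w∉B = ⊥-elim (ℕ.<⇒≱ |B|<k (subst (_≤ ∣ B ∣) (∣⊤∣≡n k) (p⊆q⇒∣p∣≤∣q∣ {p = ⊤} all-in-B)))
        where
        all-in-B : ∀ {w} → w ∈ ⊤ → w ∈ B
        all-in-B {w} _ = decidable-stable (w ∈? B) λ w∉B → ¬w∉B (w , w∉B)

    module BlockAction {m} (Q : Quotient Unseparated m) where
      open Quotient Q
      open IsDecEquivalence unseparated-isDecEquivalence using () renaming (sym to ~-sym; trans to ~-trans)

      rep-class : ∀ x → Unseparated (rep (class x)) x
      rep-class x = class-≡⇒~ (class-rep (class x))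

      unseparated-respects⁻¹ : ∀ {g} → g ∈ₗ elems L → ∀ {x y} → Unseparated x y → Unseparated (g ⟨$⟩ˡ x) (g ⟨$⟩ˡ y)
      unseparated-respects⁻¹ g∈ {x} {y} x~y =
        let (c , c∈ , c≗g⁻¹) = inverse-element L g∈ in
        subst₂ Unseparated (c≗g⁻¹ x) (c≗g⁻¹ y) (unseparated-respects c∈ x~y)

      action : ∀ l → l ∈ₗ elems L → Permutation′ m
      action l l∈ = permutation (λ c → class (l ⟨$⟩ʳ rep c)) (λ c → class (l ⟨$⟩ˡ rep c)) to∘from from∘to
        where
        to∘from : ∀ c → class (l ⟨$⟩ʳ rep (class (l ⟨$⟩ˡ rep c))) ≡ c
        to∘from c = trans (~⇒class-≡ (subst (Unseparated _) (inverseʳ l) (unseparated-respects l∈ (rep-class _))))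
                          (class-rep c)
        from∘to : ∀ c → class (l ⟨$⟩ˡ rep (class (l ⟨$⟩ʳ rep c))) ≡ c
        from∘to c = trans (~⇒class-≡ (subst (Unseparated _) (inverseˡ l) (unseparated-respects⁻¹ l∈ (rep-class _))))
                          (class-rep c)

      class-action : ∀ l (l∈ : l ∈ₗ elems L) x → class (l ⟨$⟩ʳ x) ≡ action l l∈ ⟨$⟩ʳ class x
      class-action l l∈ x = ~⇒class-≡ (unseparated-respects l∈ (~-sym (rep-class x)))

    blockSystem : IsNontrivialBlock L B → PtStabComplementNontrivial L B → BlockSystem L
    blockSystem (isBlock , _ , |B|<k) (g₀ , g₀∈ , g₀-fixes , x₀ , g₀-moves) =
      fromQuotient (quotient unseparated-isDecEquivalence)
      where
      x₀∈B : x₀ ∈ B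
      x₀∈B = decidable-stable (x₀ ∈? B) λ x₀∉B → g₀-moves (g₀-fixes x₀ x₀∉B)
      w₀ : Fin k
      w₀ = proj₁ (point-outside |B|<k)
      separated : ¬ Unseparated x₀ w₀
      separated x₀~w₀ = proj₂ (point-outside |B|<k) (unseparated-∈ x₀~w₀ x₀∈B)
      fromQuotient : ∃ (Quotient Unseparated) → BlockSystem L
      fromQuotient (zero , Q) with Quotient.class Q x₀
      ... | ()
      fromQuotient (suc zero , Q) with Quotient.class Q x₀ in eq₁ | Quotient.class Q w₀ in eq₂
      ... | zero | zero = ⊥-elim (separated (Quotient.class-≡⇒~ Q (trans eq₁ (sym eq₂))))
      fromQuotient (suc (suc d) , Q) = record
        { d = suc d
        ; 1≤d = s≤s z≤n
        ; block = class
        ; rep = rep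
        ; block-rep = class-rep
        ; action = action
        ; block-action = class-action
        ; κ = g₀
        ; κ∈L = g₀∈
        ; κ-block = class x₀
        ; κ-fixes = λ x x≁x₀ → g₀-fixes x λ x∈B → x≁x₀ (~⇒class-≡ (∈-unseparated isBlock x∈B x₀∈B))
        ; κ-moves = x₀ , g₀-moves }
        where
        open Quotient Q
        open BlockAction Q

module LocalGroups where

  open import Data.Bool using (true)
  open import Data.Empty using (⊥-elim)
  open import Data.Fin using (Fin; _≟_)
  open import Data.Fin.Properties using (all?; any?)
  open import Data.Fin.Permutation using (Permutation′; _⟨$⟩ʳ_; _⟨$⟩ˡ_; inverseˡ; inverseʳ; permutation)
  open import Data.List using (List; []; _∷_; tabulate)
  open import Data.List.Membership.Propositional using (find) renaming (_∈_ to _∈ₗ_)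
  open import Data.List.Membership.Propositional.Properties using (∈-tabulate⁺)
  open import Data.List.Relation.Unary.All as All using (All)
  open import Data.List.Relation.Unary.AllPairs using (AllPairs; []; _∷_)
  open import Data.List.Relation.Unary.Any as Any using (Any; here; there)
  open import Data.List.Relation.Unary.Unique.Propositional.Properties using (tabulate⁺)
  open import Data.Nat using (ℕ; _^_)
  open import Data.Product using (∃; _×_; _,_; proj₁; proj₂)
  open import Data.Vec as Vec using (Vec; lookup)
  import Data.Vec.Properties as Vecₚ
  open import Function using (_∘_; id)
  open import Function.Bundles using (Inverse; _↔_)
  open import Function.Properties.Inverse using (↔-refl)
  open import Relation.Binary.PropositionalEquality
  open import Relation.Nullary using (Dec; yes; no; ¬_; does)
  open import Relation.Nullary.Decidable using (_×-dec_; does-⇔; dec-true; dec-false)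
  open import Function.Bundles using (mk⇔)
  open import Defs using (PermGroup; elems; has-id; comp; inv; _≈ₚ_; Graph; E; Walk; here; step; Connected; IsAutomorphism; SubgroupOfAut; StabElem; LocallyIsoAt)
  open PermutationGroups using (IsElement; ∘-element; inverse-element)
  open Vectors using (Vec↔; lookup-injective)

  module LocalPermutations {k} (L : PermGroup k) {N} (φ : Fin N → Fin k → Fin N) where

    Local : (Fin N → Fin N) → Set
    Local f = ∀ z → Any (λ l → ∀ i → f (φ z i) ≡ φ (f z) (l ⟨$⟩ʳ i)) (elems L)

    local? : ∀ f → Dec (Local f)
    local? f = all? λ z → Any.any? (λ l → all? λ i → f (φ z i) ≟ φ (f z) (l ⟨$⟩ʳ i)) (elems L)

    local-cong : ∀ {f g} → (∀ z → f z ≡ g z) → Local f → Local g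
    local-cong {f} {g} f≗g f-local z = Any.map
      (λ {l} f-at-z i → trans (sym (f≗g _)) (trans (f-at-z i) (cong (λ w → φ w (l ⟨$⟩ʳ i)) (f≗g z))))
      (f-local z)

    local-id : Local id
    local-id z = Any.map (λ l≗id i → cong (φ z) (sym (l≗id i))) (has-id L)

    local-∘ : ∀ {f g} → Local f → Local g → Local (f ∘ g)
    local-∘ {f} {g} f-local g-local z =
      let (l₂ , l₂∈ , g-at-z) = find (g-local z)
          (l₁ , l₁∈ , f-at-gz) = find (f-local (g z)) in
      Any.map (λ {c} c≗l₁l₂ i → trans (cong f (g-at-z i)) (trans (f-at-gz (l₂ ⟨$⟩ʳ i)) (cong (φ (f (g z))) (sym (c≗l₁l₂ i)))))
              (comp L l₁ l₂ l₁∈ l₂∈)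

    local-inverse : ∀ {f g} → (∀ z → f (g z) ≡ z) → (∀ z → g (f z) ≡ z) → Local f → Local g
    local-inverse {f} {g} fg gf f-local z =
      let (l , l∈ , f-at-gz) = find (f-local (g z)) in
      Any.map (λ {c} c∘l≗id j →
        let lc : l ⟨$⟩ʳ (c ⟨$⟩ʳ j) ≡ j
            lc = trans (cong (l ⟨$⟩ʳ_) (trans (cong (c ⟨$⟩ʳ_) (sym (inverseʳ l))) (c∘l≗id (l ⟨$⟩ˡ j)))) (inverseʳ l)
        in begin
          g (φ z j)                          ≡⟨ cong (λ t → g (φ t j)) (sym (fg z)) ⟩
          g (φ (f (g z)) j)                  ≡⟨ cong (λ t → g (φ (f (g z)) t)) (sym lc) ⟩
          g (φ (f (g z)) (l ⟨$⟩ʳ (c ⟨$⟩ʳ j))) ≡⟨ cong g (sym (f-at-gz (c ⟨$⟩ʳ j))) ⟩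
          g (f (φ (g z) (c ⟨$⟩ʳ j)))         ≡⟨ gf _ ⟩
          φ (g z) (c ⟨$⟩ʳ j)                 ∎)
        (inv L l l∈)
      where open ≡-Reasoning

    private
      Table : Set
      Table = Vec (Fin N) N

      tables↔ : Fin (N ^ N) ↔ Table
      tables↔ = Vec↔ ↔-refl N
      open Inverse tables↔ using (to; from; strictlyInverseˡ; strictlyInverseʳ)

      tables : List Table
      tables = tabulate to

      tables-complete : ∀ v → v ∈ₗ tables
      tables-complete v = subst (_∈ₗ tables) (strictlyInverseˡ v) (∈-tabulate⁺ (from v))

      tables-unique : AllPairs _≢_ tables
      tables-unique = tabulate⁺ λ {i} {j} eq → trans (sym (strictlyInverseʳ i)) (trans (cong from eq) (strictlyInverseʳ j))

      Inverses : Table → Table → Set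
      Inverses v w = (∀ i → lookup v (lookup w i) ≡ i) × (∀ i → lookup w (lookup v i) ≡ i)

      Admissible : Table → Set
      Admissible v = Any (Inverses v) tables × Local (lookup v)

      admissible? : ∀ v → Dec (Admissible v)
      admissible? v =
        Any.any? (λ w → all? (λ i → lookup v (lookup w i) ≟ i) ×-dec all? (λ i → lookup w (lookup v i) ≟ i)) tables
        ×-dec local? (lookup v)

      toPermutation : ∀ v → Any (Inverses v) tables → Permutation′ N
      toPermutation v inverse = let (w , _ , vw , wv) = find inverse in permutation (lookup v) (lookup w) vw wv

      keep : ∀ v → Dec (Admissible v) → List (Permutation′ N) → List (Permutation′ N)
      keep v (yes (inverse , _)) ps = toPermutation v inverse ∷ ps
      keep v (no _) ps = ps

      collect : List Table → List (Permutation′ N)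
      collect [] = []
      collect (v ∷ vs) = keep v (admissible? v) (collect vs)

      Represents : Permutation′ N → Table → Set
      Represents p v = ∀ i → p ⟨$⟩ʳ i ≡ lookup v i

      collect-sound : ∀ vs {p} → p ∈ₗ collect vs → ∃ λ v → v ∈ₗ vs × Represents p v × Local (lookup v)
      collect-sound (v ∷ vs) {p} p∈ = keep-sound (admissible? v) p∈
        where
        keep-sound : ∀ d → p ∈ₗ keep v d (collect vs) → ∃ λ w → w ∈ₗ v ∷ vs × Represents p w × Local (lookup w)
        keep-sound (yes (_ , v-local)) (here refl) = v , here refl , (λ _ → refl) , v-local
        keep-sound (yes _) (there p∈) = let (w , w∈ , p≗w , w-local) = collect-sound vs p∈ in w , there w∈ , p≗w , w-local
        keep-sound (no _) p∈ = let (w , w∈ , p≗w , w-local) = collect-sound vs p∈ in w , there w∈ , p≗w , w-local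

      collect-complete : ∀ {vs v} → v ∈ₗ vs → Admissible v → Any (λ p → Represents p v) (collect vs)
      collect-complete {v ∷ vs} (here refl) adm with admissible? v
      ... | yes _ = here λ _ → refl
      ... | no ¬adm = ⊥-elim (¬adm adm)
      collect-complete {w ∷ vs} (there v∈) adm with admissible? w
      ... | yes _ = there (collect-complete v∈ adm)
      ... | no _ = collect-complete v∈ adm

      collect-distinct : ∀ vs → AllPairs _≢_ vs → AllPairs (λ p q → ¬ p ≈ₚ q) (collect vs)
      collect-distinct [] [] = []
      collect-distinct (v ∷ vs) (v∉vs ∷ vs-distinct) with admissible? v
      ... | yes _ = All.tabulate (λ {q} q∈ p≈q →
              let (w , w∈ , q≗w , _) = collect-sound vs q∈ in
              All.lookup v∉vs w∈ (lookup-injective λ i → trans (p≈q i) (q≗w i)))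
            ∷ collect-distinct vs vs-distinct
      ... | no _ = collect-distinct vs vs-distinct

      collect-local : ∀ {p} → p ∈ₗ collect tables → Local (p ⟨$⟩ʳ_)
      collect-local p∈ = let (v , _ , p≗v , v-local) = collect-sound tables p∈ in local-cong (λ i → sym (p≗v i)) v-local

      collect-represents : ∀ {f g : Fin N → Fin N} → Local f → (∀ i → f (g i) ≡ i) → (∀ i → g (f i) ≡ i) →
                           Any (λ p → ∀ i → p ⟨$⟩ʳ i ≡ f i) (collect tables)
      collect-represents {f} {g} f-local fg gf = Any.map (λ p≗f i → trans (p≗f i) (Vecₚ.lookup∘tabulate f i))
        (collect-complete (tables-complete (Vec.tabulate f))
          ( Any.map (λ g≡w → subst (Inverses (Vec.tabulate f)) g≡w
                      ( (λ i → trans (Vecₚ.lookup∘tabulate f _) (trans (cong f (Vecₚ.lookup∘tabulate g i)) (fg i)))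
                      , (λ i → trans (Vecₚ.lookup∘tabulate g _) (trans (cong g (Vecₚ.lookup∘tabulate f i)) (gf i)))))
                    (tables-complete (Vec.tabulate g))
          , local-cong (λ i → sym (Vecₚ.lookup∘tabulate f i)) f-local))

    opaque
      localGroup : PermGroup N
      localGroup = record
        { elems = collect tables
        ; distinct = collect-distinct tables tables-unique
        ; has-id = collect-represents local-id (λ _ → refl) (λ _ → refl)
        ; comp = λ g h g∈ h∈ → collect-represents (local-∘ (collect-local g∈) (collect-local h∈))
                   (λ i → trans (cong (g ⟨$⟩ʳ_) (inverseʳ h)) (inverseʳ g))
                   (λ i → trans (cong (h ⟨$⟩ˡ_) (inverseˡ g)) (inverseˡ h))
        ; inv = λ g g∈ → Any.map (λ p≗g⁻¹ i → trans (p≗g⁻¹ (g ⟨$⟩ʳ i)) (inverseˡ g))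
                   (collect-represents (local-inverse (λ _ → inverseʳ g) (λ _ → inverseˡ g) (collect-local g∈))
                     (λ _ → inverseˡ g) (λ _ → inverseʳ g))
        }

      element-local : ∀ {p} → p ∈ₗ elems localGroup → Local (p ⟨$⟩ʳ_)
      element-local = collect-local

      local-element : ∀ {f g : Fin N → Fin N} → Local f → (∀ i → f (g i) ≡ i) → (∀ i → g (f i) ≡ i) →
                      IsElement localGroup f
      local-element f-local fg gf = find (collect-represents f-local fg gf)

  module _ {N} {Γ : Graph N} where

    _++ʷ_ : ∀ {u v w} → Walk Γ u v → Walk Γ v w → Walk Γ u w
    here _ ++ʷ q = q
    step u v _ e p ++ʷ q = step u v _ e (p ++ʷ q)

    reverseʷ : ∀ {u v} → Walk Γ u v → Walk Γ v u
    reverseʷ (here u) = here u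
    reverseʷ (step u v w e p) = reverseʷ p ++ʷ step v u u (trans (Graph.sym Γ v u) e) (here u)

  connected-from : ∀ {N} (Γ : Graph N) z₀ → (∀ z → Walk Γ z₀ z) → Connected Γ
  connected-from Γ z₀ walk u w = reverseʷ (walk u) ++ʷ walk w

  -- φ z i is the i-th neighbour of z, and z is the (label z)-th neighbour of each of its neighbours.
  record Labelling (N k : ℕ) : Set where
    field
      φ : Fin N → Fin k → Fin N
      label : Fin N → Fin k
      label-φ : ∀ z i → label (φ z i) ≡ i
      φ-label : ∀ z i → φ (φ z i) (label z) ≡ z
      φ-irreflexive : ∀ z i → φ z i ≢ z

    Adjacent : Fin N → Fin N → Set
    Adjacent z w = ∃ λ i → φ z i ≡ w

    adjacent? : ∀ z w → Dec (Adjacent z w)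
    adjacent? z w = any? λ i → φ z i ≟ w

    adjacent-sym : ∀ {z w} → Adjacent z w → Adjacent w z
    adjacent-sym {z} (i , refl) = label z , φ-label z i

    graph : Graph N
    graph = record
      { E = λ z w → does (adjacent? z w)
      ; sym = λ z w → does-⇔ (mk⇔ adjacent-sym adjacent-sym) (adjacent? z w) (adjacent? w z)
      ; irrefl = λ z → dec-false (adjacent? z z) λ (i , φzi≡z) → φ-irreflexive z i φzi≡z }

    adjacent-φ : ∀ z i → E graph z (φ z i) ≡ true
    adjacent-φ z i = dec-true (adjacent? z (φ z i)) (i , refl)

    E⇒adjacent : ∀ z w → E graph z w ≡ true → Adjacent z w
    E⇒adjacent z w E≡true with adjacent? z w
    ... | yes adj = adj

    φ-injective : ∀ z i j → φ z i ≡ φ z j → i ≡ j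
    φ-injective z i j eq = trans (sym (label-φ z i)) (trans (cong label eq) (label-φ z j))


    module Locally (L : PermGroup k) where
      open LocalPermutations L φ public

      local⇒automorphism : ∀ p → Local (p ⟨$⟩ʳ_) → IsAutomorphism graph p
      local⇒automorphism p p-local z w =
        does-⇔ (mk⇔ back forth) (adjacent? (p ⟨$⟩ʳ z) (p ⟨$⟩ʳ w)) (adjacent? z w)
        where
        l = proj₁ (find (p-local z))
        l-at-z : ∀ i → p ⟨$⟩ʳ φ z i ≡ φ (p ⟨$⟩ʳ z) (l ⟨$⟩ʳ i)
        l-at-z = proj₂ (proj₂ (find (p-local z)))
        forth : Adjacent z w → Adjacent (p ⟨$⟩ʳ z) (p ⟨$⟩ʳ w)
        forth (i , refl) = l ⟨$⟩ʳ i , sym (l-at-z i)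
        back : Adjacent (p ⟨$⟩ʳ z) (p ⟨$⟩ʳ w) → Adjacent z w
        back (j , φpz≡pw) = l ⟨$⟩ˡ j , (begin
          φ z (l ⟨$⟩ˡ j)                                ≡⟨ inverseˡ p ⟨
          p ⟨$⟩ˡ (p ⟨$⟩ʳ φ z (l ⟨$⟩ˡ j))                ≡⟨ cong (p ⟨$⟩ˡ_) (l-at-z (l ⟨$⟩ˡ j)) ⟩
          p ⟨$⟩ˡ φ (p ⟨$⟩ʳ z) (l ⟨$⟩ʳ (l ⟨$⟩ˡ j))       ≡⟨ cong (λ i → p ⟨$⟩ˡ φ (p ⟨$⟩ʳ z) i) (inverseʳ l) ⟩
          p ⟨$⟩ˡ φ (p ⟨$⟩ʳ z) j                         ≡⟨ cong (p ⟨$⟩ˡ_) φpz≡pw ⟩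
          p ⟨$⟩ˡ (p ⟨$⟩ʳ w)                             ≡⟨ inverseˡ p ⟩
          w                                             ∎)
          where open ≡-Reasoning

      automorphisms : SubgroupOfAut graph localGroup
      automorphisms p p∈ = local⇒automorphism p (element-local p∈)

      Lifts : Fin N → Set
      Lifts z = ∀ l → l ∈ₗ elems L → ∃ λ g → StabElem localGroup z g × (∀ i → g ⟨$⟩ʳ φ z i ≡ φ z (l ⟨$⟩ʳ i))

      locallyIsoAt : ∀ z → Lifts z → LocallyIsoAt graph localGroup L z
      locallyIsoAt z lifts = φ z , φ-injective z , adjacent-φ z , E⇒adjacent z , induced , lifts
        where
        induced : ∀ g → StabElem localGroup z g → ∃ λ l → l ∈ₗ elems L × (∀ i → g ⟨$⟩ʳ φ z i ≡ φ z (l ⟨$⟩ʳ i))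
        induced g (g∈ , gz≡z) = let (l , l∈ , l-at-z) = find (element-local g∈ z) in
          l , l∈ , λ i → trans (l-at-z i) (cong (λ t → φ t (l ⟨$⟩ʳ i)) gz≡z)

      lifts-transport : ∀ {z₀ t} → Lifts z₀ → t ∈ₗ elems localGroup → Lifts (t ⟨$⟩ʳ z₀)
      lifts-transport {z₀} {t} lifts₀ t∈ l l∈ = g , (g∈ , g-fixes) , g-acts
        where
        open ≡-Reasoning
        z = t ⟨$⟩ʳ z₀
        lₜ = proj₁ (find (element-local t∈ z₀))
        lₜ∈ = proj₁ (proj₂ (find (element-local t∈ z₀)))
        t-at-z₀ : ∀ i → t ⟨$⟩ʳ φ z₀ i ≡ φ z (lₜ ⟨$⟩ʳ i)
        t-at-z₀ = proj₂ (proj₂ (find (element-local t∈ z₀)))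
        conjugate = ∘-element L (inverse-element L lₜ∈) (∘-element L (l , l∈ , λ _ → refl) (lₜ , lₜ∈ , λ _ → refl))
        l₀ = proj₁ conjugate
        l₀≗ : ∀ i → l₀ ⟨$⟩ʳ i ≡ lₜ ⟨$⟩ˡ (l ⟨$⟩ʳ (lₜ ⟨$⟩ʳ i))
        l₀≗ = proj₂ (proj₂ conjugate)
        lift₀ = lifts₀ l₀ (proj₁ (proj₂ conjugate))
        g₀ = proj₁ lift₀
        g₀-acts : ∀ i → g₀ ⟨$⟩ʳ φ z₀ i ≡ φ z₀ (l₀ ⟨$⟩ʳ i)
        g₀-acts = proj₂ (proj₂ lift₀)
        element = ∘-element localGroup (t , t∈ , λ _ → refl)
                    (∘-element localGroup (g₀ , proj₁ (proj₁ (proj₂ lift₀)) , λ _ → refl) (inverse-element localGroup t∈))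
        g = proj₁ element
        g∈ = proj₁ (proj₂ element)
        g≗ : ∀ x → g ⟨$⟩ʳ x ≡ t ⟨$⟩ʳ (g₀ ⟨$⟩ʳ (t ⟨$⟩ˡ x))
        g≗ = proj₂ (proj₂ element)
        g-fixes : g ⟨$⟩ʳ z ≡ z
        g-fixes = trans (g≗ z) (cong (t ⟨$⟩ʳ_) (trans (cong (g₀ ⟨$⟩ʳ_) (inverseˡ t)) (proj₂ (proj₁ (proj₂ lift₀)))))
        φz-via-t : ∀ i → φ z i ≡ t ⟨$⟩ʳ φ z₀ (lₜ ⟨$⟩ˡ i)
        φz-via-t i = trans (cong (φ z) (sym (inverseʳ lₜ))) (sym (t-at-z₀ (lₜ ⟨$⟩ˡ i)))
        g-acts : ∀ i → g ⟨$⟩ʳ φ z i ≡ φ z (l ⟨$⟩ʳ i)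
        g-acts i = begin
          g ⟨$⟩ʳ φ z i
            ≡⟨ g≗ (φ z i) ⟩
          t ⟨$⟩ʳ (g₀ ⟨$⟩ʳ (t ⟨$⟩ˡ φ z i))
            ≡⟨ cong (λ x → t ⟨$⟩ʳ (g₀ ⟨$⟩ʳ (t ⟨$⟩ˡ x))) (φz-via-t i) ⟩
          t ⟨$⟩ʳ (g₀ ⟨$⟩ʳ (t ⟨$⟩ˡ (t ⟨$⟩ʳ φ z₀ (lₜ ⟨$⟩ˡ i))))
            ≡⟨ cong (λ x → t ⟨$⟩ʳ (g₀ ⟨$⟩ʳ x)) (inverseˡ t) ⟩
          t ⟨$⟩ʳ (g₀ ⟨$⟩ʳ φ z₀ (lₜ ⟨$⟩ˡ i))
            ≡⟨ cong (t ⟨$⟩ʳ_) (g₀-acts (lₜ ⟨$⟩ˡ i)) ⟩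
          t ⟨$⟩ʳ φ z₀ (l₀ ⟨$⟩ʳ (lₜ ⟨$⟩ˡ i))
            ≡⟨ cong (λ j → t ⟨$⟩ʳ φ z₀ j) (trans (l₀≗ _) (cong (λ j → lₜ ⟨$⟩ˡ (l ⟨$⟩ʳ j)) (inverseʳ lₜ))) ⟩
          t ⟨$⟩ʳ φ z₀ (lₜ ⟨$⟩ˡ (l ⟨$⟩ʳ i))
            ≡⟨ φz-via-t (l ⟨$⟩ʳ i) ⟨
          φ z (l ⟨$⟩ʳ i) ∎

module Arithmetic where

  open import Data.Nat using (zero; suc; _+_; _*_; _^_; _≤_; z≤n; s≤s)
  open import Data.Nat.Properties
  open import Data.Nat.Solver using (module +-*-Solver)
  open import Relation.Binary.PropositionalEquality

  open +-*-Solver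

  ^-distribʳ-* : ∀ a b c → (a * b) ^ c ≡ a ^ c * b ^ c
  ^-distribʳ-* a b zero = refl
  ^-distribʳ-* a b (suc c) = trans (cong (a * b *_) (^-distribʳ-* a b c)) ([m*n]*[o*p]≡[m*o]*[n*p] a b (a ^ c) (b ^ c))

  m≤m^n : ∀ m {n} → 1 ≤ n → m ≤ m ^ n
  m≤m^n zero (s≤s _) = z≤n
  m≤m^n (suc m) {suc n} _ = m≤m*n (suc m) (suc m ^ n) {{m^n≢0 (suc m) n}}

  -- (1 + 1/x)^j ≤ x/r for r = x - j, cleared of denominators.
  [1+x]^j*r≤x^j*x : ∀ x j r → j + r ≡ x → suc x ^ j * r ≤ x ^ j * x
  [1+x]^j*r≤x^j*x x zero r refl = ≤-refl
  [1+x]^j*r≤x^j*x x (suc j) r j+1+r≡x = begin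
    suc x * suc x ^ j * r   ≡⟨ solve 3 (λ a b r → a :* b :* r := b :* (a :* r)) refl (suc x) (suc x ^ j) r ⟩
    suc x ^ j * (suc x * r) ≤⟨ *-monoʳ-≤ (suc x ^ j) [1+x]*r≤x*[1+r] ⟩
    suc x ^ j * (x * suc r) ≡⟨ solve 3 (λ a b r → a :* (b :* r) := b :* (a :* r)) refl (suc x ^ j) x (suc r) ⟩
    x * (suc x ^ j * suc r) ≤⟨ *-monoʳ-≤ x ([1+x]^j*r≤x^j*x x j (suc r) (trans (+-suc j r) j+1+r≡x)) ⟩
    x * (x ^ j * x)         ≡⟨ *-assoc x (x ^ j) x ⟨
    x * x ^ j * x           ∎
    where
    open ≤-Reasoning
    [1+x]*r≤x*[1+r] : suc x * r ≤ x * suc r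
    [1+x]*r≤x*[1+r] = begin
      suc x * r   ≡⟨⟩
      r + x * r   ≤⟨ +-monoˡ-≤ (x * r) (subst (r ≤_) j+1+r≡x (m≤n+m r (suc j))) ⟩
      x + x * r   ≡⟨ *-suc x r ⟨
      x * suc r   ∎

  growth-rate : ∀ k → suc (4 * suc k) ^ (2 * suc k) ≤ 2 * (4 * suc k) ^ (2 * suc k)
  growth-rate k = *-cancelʳ-≤ _ _ j (begin
    suc x ^ j * j
      ≤⟨ [1+x]^j*r≤x^j*x x j j (solve 1 (λ k → con 2 :* (con 1 :+ k) :+ con 2 :* (con 1 :+ k) := con 4 :* (con 1 :+ k))
                                 refl k) ⟩
    x ^ j * x
      ≡⟨ solve 2 (λ a k → a :* (con 4 :* (con 1 :+ k)) := con 2 :* a :* (con 2 :* (con 1 :+ k))) refl (x ^ j) k ⟩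
    2 * x ^ j * j ∎)
    where
    open ≤-Reasoning
    x = 4 * suc k
    j = 2 * suc k

  exponential-bound : ∀ k X S → 2 ^ X ≤ S →
                      suc (4 * suc k) ^ (2 * (suc k * X)) ≤ (4 * suc k) ^ (2 * (suc k * X)) * S
  exponential-bound k X S 2^X≤S = begin
    p ^ (2 * (suc k * X))     ≡⟨ cong (p ^_) (*-assoc 2 (suc k) X) ⟨
    p ^ (j * X)               ≡⟨ ^-*-assoc p j X ⟨
    (p ^ j) ^ X               ≤⟨ ^-monoˡ-≤ X (growth-rate k) ⟩
    (2 * q ^ j) ^ X           ≡⟨ ^-distribʳ-* 2 (q ^ j) X ⟩
    2 ^ X * (q ^ j) ^ X       ≤⟨ *-monoˡ-≤ ((q ^ j) ^ X) 2^X≤S ⟩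
    S * (q ^ j) ^ X           ≡⟨ *-comm S ((q ^ j) ^ X) ⟩
    (q ^ j) ^ X * S           ≡⟨ cong (_* S) (trans (^-*-assoc q j X) (cong (q ^_) (*-assoc 2 (suc k) X))) ⟩
    q ^ (2 * (suc k * X)) * S ∎
    where
    open ≤-Reasoning
    p = suc (4 * suc k)
    q = 4 * suc k
    j = 2 * suc k

module Cover where

  open import Algebra.Structures using (IsAbelianGroup)
  import Algebra.Properties.AbelianGroup as AbelianGroupProperties
  open import Data.Bool using (Bool; true; false; not)
  open import Data.Empty using (⊥-elim)
  open import Data.Fin using (Fin; zero; suc; _≟_)
  open import Data.Fin.Properties using (*↔×; 2↔Bool; nonZeroIndex)
  open import Data.Nat.Properties using (n≤1+n; m≤n*m; module ≤-Reasoning)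
  open Arithmetic using (m≤m^n)
  open import Data.Fin.Permutation using (Permutation′; _⟨$⟩ʳ_; _⟨$⟩ˡ_; inverseˡ; inverseʳ; flip)
  open import Data.List.Membership.Propositional using (lose) renaming (_∈_ to _∈ₗ_)
  open import Data.Nat using (ℕ; suc; _*_; _^_; _≤_)
  open import Data.Product using (∃; _×_; _,_; proj₁; proj₂)
  open import Data.Product.Function.NonDependent.Propositional using (_×-↔_)
  open import Function using (id; _∘_)
  open import Function.Bundles using (_↔_; Inverse; Injection)
  open import Function.Properties.Inverse using (↔-refl; ↔-trans; ↔⇒↣)
  open import Relation.Binary.PropositionalEquality
  open import Relation.Nullary using (yes; no)
  open import Defs using (PermGroup; elems; Transitive; Walk; here; step; E; Connected; stabOrder; LPair)
  open import Data.Vec using (Vec; lookup)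
  open Vectors using (Vec↔; lookup-injective)
  open AbelianGroups using (≡-abelianGroup; additive⇒-; additive⇒0)
  open PermutationGroups using (IsElement; ∘-element; id-element; transitive-from; stabOrder-≥)
  open Blocks using (BlockSystem)
  open LocalGroups using (Labelling; _++ʷ_; reverseʷ; connected-from)

  module CoverGraph {k} (L : PermGroup k) (L-transitive : Transitive L) (S : BlockSystem L) (n : ℕ) where

    open BlockSystem S
    open Homology n d

    private
      module Mat-laws = IsAbelianGroup isAbelianGroup
      module Mat-props = AbelianGroupProperties (≡-abelianGroup isAbelianGroup)

      +-swapʳ : ∀ A B C → (A + B) + C ≡ (A + C) + B
      +-swapʳ A B C = trans (Mat-laws.assoc A B C) (trans (cong (A +_) (Mat-laws.comm B C)) (sym (Mat-laws.assoc A C B)))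

    -- (b , ω , M) lies over the vertex (b , block ω) of K_{d+1,d+1}, in the fibre Mat over it.
    Vertex : Set
    Vertex = Bool × Fin k × Mat

    -- The fibre coordinate of the neighbours of a vertex lying in block c.
    fibre : Vertex → Fin (suc d) → Mat
    fibre (false , ω , M) c = M + voltage (block ω) c
    fibre (true , ω , M) c = M - voltage c (block ω)

    ν : Vertex → Fin k → Vertex
    ν v@(b , _ , _) i = not b , i , fibre v (block i)

    ν-back : ∀ v i → ν (ν v i) (proj₁ (proj₂ v)) ≡ v
    ν-back (false , ω , M) i = cong (λ X → false , ω , X) (Mat-props.//-rightDividesʳ _ M)
    ν-back (true , ω , M) i = cong (λ X → true , ω , X) (Mat-props.//-rightDividesˡ _ M)

    X : ℕ
    X = (suc n ^ d) ^ d

    size : ℕ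
    size = 2 * (k * X)

    n≤size : n ≤ size
    n≤size = begin
      n           ≤⟨ n≤1+n n ⟩
      suc n       ≤⟨ m≤m^n (suc n) 1≤d ⟩
      suc n ^ d   ≤⟨ m≤m^n (suc n ^ d) 1≤d ⟩
      X           ≤⟨ m≤n*m X k {{nonZeroIndex (proj₁ κ-moves)}} ⟩
      k * X       ≤⟨ m≤n*m (k * X) 2 ⟩
      size        ∎
      where open ≤-Reasoning

    Mat↔ : Fin X ↔ Mat
    Mat↔ = Vec↔ (Vec↔ ↔-refl d) d

    opaque
      vertex↔ : Fin size ↔ Vertex
      vertex↔ = ↔-trans *↔× (2↔Bool ×-↔ ↔-trans *↔× (↔-refl ×-↔ Mat↔))

    open Inverse vertex↔ public using ()
      renaming (to to decode; from to encode; strictlyInverseˡ to decode∘encode; strictlyInverseʳ to encode∘decode)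

    labelling : Labelling size k
    labelling = record
      { φ = λ z i → encode (ν (decode z) i)
      ; label = λ z → proj₁ (proj₂ (decode z))
      ; label-φ = λ z i → cong (proj₁ ∘ proj₂) (decode∘encode (ν (decode z) i))
      ; φ-label = λ z i → trans (cong (λ v → encode (ν v _)) (decode∘encode _))
                                (trans (cong encode (ν-back (decode z) i)) (encode∘decode z))
      ; φ-irreflexive = λ z i eq → not-≢ (cong proj₁ (trans (sym (decode∘encode _)) (cong decode eq)))
      }
      where
      not-≢ : ∀ {b} → not b ≢ b
      not-≢ {false} ()
      not-≢ {true} ()

    record Symmetry : Set where
      field
        apply unapply : Vertex → Vertex
        apply∘unapply : ∀ v → apply (unapply v) ≡ v
        unapply∘apply : ∀ v → unapply (apply v) ≡ v
        local : ∀ v → ∃ λ f → IsElement L f × (∀ i → apply (ν v i) ≡ ν (apply v) (f i))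
    open Symmetry

    _∘ˢ_ : Symmetry → Symmetry → Symmetry
    σ ∘ˢ τ = record
      { apply = apply σ ∘ apply τ
      ; unapply = unapply τ ∘ unapply σ
      ; apply∘unapply = λ v → trans (cong (apply σ) (apply∘unapply τ _)) (apply∘unapply σ v)
      ; unapply∘apply = λ v → trans (cong (unapply τ) (unapply∘apply σ _)) (unapply∘apply τ v)
      ; local = λ v →
          let (f , f∈L , τ-at-v) = local τ v
              (g , g∈L , σ-at-τv) = local σ (apply τ v) in
          g ∘ f , ∘-element L g∈L f∈L , λ i → trans (cong (apply σ) (τ-at-v i)) (σ-at-τv (f i)) }

    translation : Mat → Symmetry
    translation T = record
      { apply = λ (b , ω , M) → b , ω , M + T
      ; unapply = λ (b , ω , M) → b , ω , M - T
      ; apply∘unapply = λ (b , ω , M) → cong (λ Y → b , ω , Y) (Mat-props.//-rightDividesˡ T M)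
      ; unapply∘apply = λ (b , ω , M) → cong (λ Y → b , ω , Y) (Mat-props.//-rightDividesʳ T M)
      ; local = λ v → id , id-element L , λ i → cong (λ Y → _ , i , Y) (translate-fibre v (block i)) }
      where
      translate-fibre : ∀ v c → fibre v c + T ≡ fibre (proj₁ v , proj₁ (proj₂ v) , proj₂ (proj₂ v) + T) c
      translate-fibre (false , ω , M) c = +-swapʳ M _ T
      translate-fibre (true , ω , M) c = +-swapʳ M _ T

    swap : Symmetry
    swap = record
      { apply = flip-side
      ; unapply = flip-side
      ; apply∘unapply = flip-side-involutive
      ; unapply∘apply = flip-side-involutive
      ; local = λ v → id , id-element L , λ i → cong (λ Y → _ , i , Y) (swap-fibre v (block i)) }
      where
      flip-side : Vertex → Vertex
      flip-side (b , ω , M) = not b , ω , transposeNeg M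
      flip-side-involutive : ∀ v → flip-side (flip-side v) ≡ v
      flip-side-involutive (false , ω , M) = cong (λ Y → false , ω , Y) (transposeNeg-involutive M)
      flip-side-involutive (true , ω , M) = cong (λ Y → true , ω , Y) (transposeNeg-involutive M)
      transposeNeg-neg : ∀ A → transposeNeg (- A) ≡ - transposeNeg A
      transposeNeg-neg = additive⇒- isAbelianGroup transposeNeg transposeNeg-+
      swap-fibre : ∀ v c → transposeNeg (fibre v c) ≡ fibre (flip-side v) c
      swap-fibre (false , ω , M) c =
        trans (transposeNeg-+ M (voltage (block ω) c)) (cong (transposeNeg M +_) (transposeNeg-voltage (block ω) c))
      swap-fibre (true , ω , M) c = begin
        transposeNeg (M - voltage c (block ω))
          ≡⟨ transposeNeg-+ M (- voltage c (block ω)) ⟩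
        transposeNeg M + transposeNeg (- voltage c (block ω))
          ≡⟨ cong (transposeNeg M +_) (transposeNeg-neg (voltage c (block ω))) ⟩
        transposeNeg M + - transposeNeg (voltage c (block ω))
          ≡⟨ cong (λ A → transposeNeg M + - A) (transposeNeg-voltage c (block ω)) ⟩
        transposeNeg M + - - voltage (block ω) c
          ≡⟨ cong (transposeNeg M +_) (Mat-props.⁻¹-involutive (voltage (block ω) c)) ⟩
        transposeNeg M + voltage (block ω) c ∎
        where open ≡-Reasoning

    module Lift (l : Permutation′ k) (l∈ : l ∈ₗ elems L) where

      private
        π = action l l∈
        α = permuteColumns π

      -- The lift of the automorphism of K_{d+1,d+1} permuting the blocks of the true side by π; the shift
      -- on the false side compensates for the spanning-tree edges moved by π.
      up : Vertex → Vertex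
      up (false , ω , M) = false , ω , α M - voltage (block ω) (π ⟨$⟩ʳ zero)
      up (true , ω , M) = true , l ⟨$⟩ʳ ω , α M

      down : Vertex → Vertex
      down (false , ω , M) = false , ω , permuteColumns (flip π) (M + voltage (block ω) (π ⟨$⟩ʳ zero))
      down (true , ω , M) = true , l ⟨$⟩ˡ ω , permuteColumns (flip π) M

      up-false : ∀ ω M i → up (ν (false , ω , M) i) ≡ ν (up (false , ω , M)) (l ⟨$⟩ʳ i)
      up-false ω M i = cong (λ Y → true , l ⟨$⟩ʳ i , Y) (begin
        α (M + voltage c (block i))
          ≡⟨ permuteColumns-+ π M _ ⟩
        α M + α (voltage c (block i))
          ≡⟨ cong (α M +_) (permuteColumns-voltage π c (block i)) ⟩
        α M + (voltage c (π ⟨$⟩ʳ block i) - voltage c (π ⟨$⟩ʳ zero))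
          ≡⟨ Mat-laws.assoc (α M) _ _ ⟨
        (α M + voltage c (π ⟨$⟩ʳ block i)) - voltage c (π ⟨$⟩ʳ zero)
          ≡⟨ +-swapʳ (α M) _ _ ⟩
        (α M - voltage c (π ⟨$⟩ʳ zero)) + voltage c (π ⟨$⟩ʳ block i)
          ≡⟨ cong (λ b → (α M - voltage c (π ⟨$⟩ʳ zero)) + voltage c b) (block-action l l∈ i) ⟨
        (α M - voltage c (π ⟨$⟩ʳ zero)) + voltage c (block (l ⟨$⟩ʳ i)) ∎)
        where
        open ≡-Reasoning
        c = block ω

      up-true : ∀ ω M i → up (ν (true , ω , M) i) ≡ ν (up (true , ω , M)) i
      up-true ω M i = cong (λ Y → false , i , Y) (begin
        α (M - voltage b c) - voltage b (π ⟨$⟩ʳ zero)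
          ≡⟨ cong (_- voltage b (π ⟨$⟩ʳ zero)) α-M-v ⟩
        (α M - (voltage b (π ⟨$⟩ʳ c) - voltage b (π ⟨$⟩ʳ zero))) - voltage b (π ⟨$⟩ʳ zero)
          ≡⟨ cancel (α M) _ _ ⟩
        α M - voltage b (π ⟨$⟩ʳ c)
          ≡⟨ cong (λ e → α M - voltage b e) (block-action l l∈ ω) ⟨
        α M - voltage b (block (l ⟨$⟩ʳ ω)) ∎)
        where
        open ≡-Reasoning
        b = block i
        c = block ω
        α-M-v : α (M - voltage b c) ≡ α M - (voltage b (π ⟨$⟩ʳ c) - voltage b (π ⟨$⟩ʳ zero))
        α-M-v = trans (permuteColumns-+ π M _)
                      (cong (α M +_) (trans (permuteColumns-neg π _) (cong -_ (permuteColumns-voltage π b c))))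
        cancel : ∀ A B C → (A - (B - C)) - C ≡ A - B
        cancel A B C = begin
          (A - (B - C)) - C   ≡⟨ cong (λ D → (A + D) - C) (Mat-props.⁻¹-anti-homo‿- B C) ⟩
          (A + (C - B)) - C   ≡⟨ Mat-laws.assoc A _ _ ⟩
          A + ((C - B) - C)   ≡⟨ cong (A +_) (+-swapʳ C _ _) ⟩
          A + ((C - C) - B)   ≡⟨ cong (λ D → A + (D - B)) (Mat-laws.inverseʳ C) ⟩
          A + (0# - B)        ≡⟨ cong (A +_) (Mat-laws.identityˡ _) ⟩
          A - B               ∎

      symmetry : Symmetry
      symmetry = record
        { apply = up
        ; unapply = down
        ; apply∘unapply = λ
            { (false , ω , M) → cong (λ Y → false , ω , Y)
                (trans (cong (_- voltage (block ω) (π ⟨$⟩ʳ zero)) (permuteColumns-inverseʳ π _))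
                       (Mat-props.//-rightDividesʳ _ M))
            ; (true , ω , M) → cong₂ (λ x Y → true , x , Y) (inverseʳ l) (permuteColumns-inverseʳ π M) }
        ; unapply∘apply = λ
            { (false , ω , M) → cong (λ Y → false , ω , Y)
                (trans (cong (permuteColumns (flip π)) (Mat-props.//-rightDividesˡ _ (α M))) (permuteColumns-inverseˡ π M))
            ; (true , ω , M) → cong₂ (λ x Y → true , x , Y) (inverseˡ l) (permuteColumns-inverseˡ π M) }
        ; local = λ
            { (false , ω , M) → l ⟨$⟩ʳ_ , (l , l∈ , λ _ → refl) , up-false ω M
            ; (true , ω , M) → id , id-element L , up-true ω M } }

    κ-if : Bool → Fin k → Fin k
    κ-if true = κ ⟨$⟩ʳ_
    κ-if false = id

    κ-if⁻¹ : Bool → Fin k → Fin k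
    κ-if⁻¹ true = κ ⟨$⟩ˡ_
    κ-if⁻¹ false = id

    block-κ-if : ∀ s x → block (κ-if s x) ≡ block x
    block-κ-if true = block-κ
    block-κ-if false x = refl

    κ-if-fixes : ∀ s x → block x ≢ κ-block → κ-if s x ≡ x
    κ-if-fixes true = κ-fixes
    κ-if-fixes false x _ = refl

    κ-if-element : ∀ s → IsElement L (κ-if s)
    κ-if-element true = κ , κ∈L , λ _ → refl
    κ-if-element false = id-element L

    fibre-block : ∀ b {ω ω'} M c → block ω ≡ block ω' → fibre (b , ω , M) c ≡ fibre (b , ω' , M) c
    fibre-block false M c eq = cong (λ e → M + voltage e c) eq
    fibre-block true M c eq = cong (λ e → M - voltage c e) eq

    kernel : (Bool → Mat → Bool) → Symmetry
    kernel sel = record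
      { apply = λ (b , ω , M) → b , κ-if (sel b M) ω , M
      ; unapply = λ (b , ω , M) → b , κ-if⁻¹ (sel b M) ω , M
      ; apply∘unapply = λ (b , ω , M) → cong (λ x → b , x , M) (κ-if-inverseʳ (sel b M) ω)
      ; unapply∘apply = λ (b , ω , M) → cong (λ x → b , x , M) (κ-if-inverseˡ (sel b M) ω)
      ; local = λ v@(b , ω , M) → κ-if (sel (not b) (fibre v κ-block)) , κ-if-element (sel (not b) (fibre v κ-block)) , λ i →
          cong₂ (λ x Y → not b , x , Y) (same-selection v i)
            (trans (fibre-block b M (block i) (sym (block-κ-if (sel b M) ω)))
                   (cong (fibre (b , κ-if (sel b M) ω , M)) (sym (block-κ-if (sel (not b) (fibre v κ-block)) i)))) }
      where
      κ-if-inverseʳ : ∀ s x → κ-if s (κ-if⁻¹ s x) ≡ x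
      κ-if-inverseʳ true x = inverseʳ κ
      κ-if-inverseʳ false x = refl
      κ-if-inverseˡ : ∀ s x → κ-if⁻¹ s (κ-if s x) ≡ x
      κ-if-inverseˡ true x = inverseˡ κ
      κ-if-inverseˡ false x = refl
      -- κ fixes the points outside κ-block, and the neighbours in κ-block share one fibre coordinate.
      same-selection : ∀ v i → κ-if (sel (not (proj₁ v)) (fibre v (block i))) i
                             ≡ κ-if (sel (not (proj₁ v)) (fibre v κ-block)) i
      same-selection v i with block i ≟ κ-block
      ... | yes i∈κ-block = cong (λ c → κ-if (sel _ (fibre v c)) i) i∈κ-block
      ... | no i∉κ-block = trans (κ-if-fixes (sel (not (proj₁ v)) (fibre v (block i))) i i∉κ-block)
                                 (sym (κ-if-fixes (sel (not (proj₁ v)) (fibre v κ-block)) i i∉κ-block))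

    open Labelling labelling using (graph; adjacent-φ)
    open Labelling.Locally labelling L

    element : (σ : Symmetry) → IsElement localGroup (encode ∘ apply σ ∘ decode)
    element σ = local-element σ-local
      (λ z → trans (cong (encode ∘ apply σ) (decode∘encode _)) (trans (cong encode (apply∘unapply σ _)) (encode∘decode z)))
      (λ z → trans (cong (encode ∘ unapply σ) (decode∘encode _)) (trans (cong encode (unapply∘apply σ _)) (encode∘decode z)))
      where
      σ-local : Local (encode ∘ apply σ ∘ decode)
      σ-local z = let (f , (l , l∈ , l≗f) , σ-at) = local σ (decode z) in lose l∈ λ i → begin
        encode (apply σ (decode (encode (ν (decode z) i)))) ≡⟨ cong (encode ∘ apply σ) (decode∘encode _) ⟩
        encode (apply σ (ν (decode z) i))                   ≡⟨ cong encode (σ-at i) ⟩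
        encode (ν (apply σ (decode z)) (f i))               ≡⟨ cong (λ j → encode (ν (apply σ (decode z)) j)) (l≗f i) ⟨
        encode (ν (apply σ (decode z)) (l ⟨$⟩ʳ i))          ≡⟨ cong (λ v → encode (ν v (l ⟨$⟩ʳ i))) (decode∘encode _) ⟨
        encode (ν (decode (encode (apply σ (decode z)))) (l ⟨$⟩ʳ i)) ∎
        where open ≡-Reasoning

    element-maps : ∀ σ v → proj₁ (element σ) ⟨$⟩ʳ encode v ≡ encode (apply σ v)
    element-maps σ v = trans (proj₂ (proj₂ (element σ)) (encode v)) (cong (encode ∘ apply σ) (decode∘encode v))

    ω₀ : Fin k
    ω₀ = rep zero

    v₀ : Vertex
    v₀ = false , ω₀ , 0#

    z₀ : Fin size
    z₀ = encode v₀

    private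
      transposeNeg-0 : transposeNeg 0# ≡ 0#
      transposeNeg-0 = additive⇒0 isAbelianGroup transposeNeg transposeNeg-+

      voltage-ω₀ : ∀ c → voltage (block ω₀) c ≡ 0#
      voltage-ω₀ c = cong (λ e → voltage e c) (block-rep zero)

      -0≡ : ∀ A → A - 0# ≡ A
      -0≡ A = trans (cong (A +_) Mat-props.ε⁻¹≈ε) (Mat-laws.identityʳ A)

    reach : ∀ v → ∃ λ σ → apply σ v₀ ≡ v
    reach (b , ω , M) = let (σ , σv₀≡) = side b in
      translation M ∘ˢ σ , trans (cong (apply (translation M)) σv₀≡) (cong (λ Y → b , ω , Y) (Mat-laws.identityˡ M))
      where
      l = proj₁ (L-transitive ω₀ ω)
      l∈ = proj₁ (proj₂ (L-transitive ω₀ ω))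
      lifted = Lift.symmetry l l∈
      to-true : apply (lifted ∘ˢ swap) v₀ ≡ (true , ω , 0#)
      to-true = cong₂ (λ x Y → true , x , Y) (proj₂ (proj₂ (L-transitive ω₀ ω)))
                  (trans (cong (permuteColumns (action l l∈)) transposeNeg-0) (permuteColumns-0 (action l l∈)))
      side : ∀ b → ∃ λ σ → apply σ v₀ ≡ (b , ω , 0#)
      side true = lifted ∘ˢ swap , to-true
      side false = swap ∘ˢ (lifted ∘ˢ swap) , trans (cong (apply swap) to-true) (cong (λ Y → false , ω , Y) transposeNeg-0)

    moves-base-to : ∀ z → ∃ λ g → g ∈ₗ elems localGroup × g ⟨$⟩ʳ z₀ ≡ z
    moves-base-to z = let (σ , σv₀≡) = reach (decode z) in
      proj₁ (element σ) , proj₁ (proj₂ (element σ)) ,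
      trans (element-maps σ v₀) (trans (cong encode σv₀≡) (encode∘decode z))

    lifts-at-base : Lifts z₀
    lifts-at-base l l∈ = g , (g∈ , fixes) , acts
      where
      open Lift l l∈
      g = proj₁ (element symmetry)
      g∈ = proj₁ (proj₂ (element symmetry))
      up-v₀ : up v₀ ≡ v₀
      up-v₀ = cong (λ Y → false , ω₀ , Y)
        (trans (cong₂ _-_ (permuteColumns-0 (action l l∈)) (voltage-ω₀ _)) (-0≡ 0#))
      fixes : g ⟨$⟩ʳ z₀ ≡ z₀
      fixes = trans (element-maps symmetry v₀) (cong encode up-v₀)
      acts : ∀ i → g ⟨$⟩ʳ encode (ν (decode z₀) i) ≡ encode (ν (decode z₀) (l ⟨$⟩ʳ i))
      acts i = begin
        g ⟨$⟩ʳ encode (ν (decode z₀) i) ≡⟨ cong (λ v → g ⟨$⟩ʳ encode (ν v i)) (decode∘encode v₀) ⟩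
        g ⟨$⟩ʳ encode (ν v₀ i)          ≡⟨ element-maps symmetry (ν v₀ i) ⟩
        encode (up (ν v₀ i))            ≡⟨ cong encode (up-false ω₀ 0# i) ⟩
        encode (ν (up v₀) (l ⟨$⟩ʳ i))   ≡⟨ cong (λ v → encode (ν v (l ⟨$⟩ʳ i))) (trans up-v₀ (sym (decode∘encode v₀))) ⟩
        encode (ν (decode z₀) (l ⟨$⟩ʳ i)) ∎
        where open ≡-Reasoning

    private
      edge : ∀ v i {w} → ν v i ≡ w → Walk graph (encode v) (encode w)
      edge v i refl = step (encode v) _ _ (trans (cong (λ u → E graph (encode v) (encode (ν u i))) (sym (decode∘encode v)))
                                                 (adjacent-φ (encode v) i)) (here _)

      to-base-point : ∀ v → Walk graph (encode v) (encode (false , ω₀ , proj₂ (proj₂ v)))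
      to-base-point (true , ω , M) =
        edge (true , ω , M) ω₀ (cong (λ Y → false , ω₀ , Y) (trans (cong (λ A → M - A) (voltage-ω₀ (block ω))) (-0≡ M)))
      to-base-point (false , ω , M) =
        edge (false , ω , M) ω₀ (cong (λ Y → true , ω₀ , Y) to-M) ++ʷ to-base-point (true , ω₀ , M)
        where
        to-M : M + voltage (block ω) (block ω₀) ≡ M
        to-M = trans (cong (λ c → M + voltage (block ω) c) (block-rep zero))
                     (trans (cong (M +_) (voltage-zeroʳ (block ω))) (Mat-laws.identityʳ M))

      -- The closed walk through the blocks 0, c', c, 0 of K_{d+1,d+1} has voltage - voltage c c'.
      around : ∀ M c c' → Walk graph (encode (false , ω₀ , M)) (encode (false , ω₀ , M - voltage c c'))
      around M c c' =
        edge (false , ω₀ , M) (rep c')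
          (cong (λ Y → true , rep c' , Y) (trans (cong (M +_) (voltage-ω₀ _)) (Mat-laws.identityʳ M)))
        ++ʷ (edge (true , rep c' , M) (rep c) (cong₂ (λ a b → false , rep c , M - voltage a b) (block-rep c) (block-rep c'))
        ++ʷ to-base-point (false , rep c , M - voltage c c'))

      from-base : ∀ M → Walk graph z₀ (encode (false , ω₀ , M))
      from-base = generates-voltage (λ M → Walk graph z₀ (encode (false , ω₀ , M))) (here _) λ A (i , j , _) walk →
        let Eᵢⱼ = voltage (suc i) (suc j) in
        walk ++ʷ reverseʷ (subst (λ B → Walk graph (encode (false , ω₀ , A + Eᵢⱼ)) (encode (false , ω₀ , B)))
                                 (Mat-props.//-rightDividesʳ Eᵢⱼ A) (around (A + Eᵢⱼ) (suc i) (suc j)))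

    connected : Connected graph
    connected = connected-from graph z₀ λ z →
      subst (Walk graph z₀) (encode∘decode z) (from-base _ ++ʷ reverseʷ (to-base-point (decode z)))

    onSide : Bool → (Mat → Bool) → Bool → Mat → Bool
    onSide true s true M = s M
    onSide false s false M = s M
    onSide true s false M = false
    onSide false s true M = false

    private
      onSide-other : ∀ b s M → onSide (not b) s b M ≡ false
      onSide-other false s M = refl
      onSide-other true s M = refl

      onSide-same : ∀ b s M → onSide (not b) s (not b) M ≡ s M
      onSide-same false s M = refl
      onSide-same true s M = refl

      κ-if-flag : ∀ {s s'} → κ-if s (proj₁ κ-moves) ≡ κ-if s' (proj₁ κ-moves) → s ≡ s'
      κ-if-flag {true} {true} _ = refl
      κ-if-flag {false} {false} _ = refl
      κ-if-flag {true} {false} eq = ⊥-elim (proj₂ κ-moves eq)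
      κ-if-flag {false} {true} eq = ⊥-elim (proj₂ κ-moves (sym eq))

      same-element⇒same-apply : ∀ σ τ → proj₁ (element σ) ≡ proj₁ (element τ) → ∀ v → apply σ v ≡ apply τ v
      same-element⇒same-apply σ τ eq v = begin
        apply σ v                                  ≡⟨ decode∘encode (apply σ v) ⟨
        decode (encode (apply σ v))                ≡⟨ cong decode (element-maps σ v) ⟨
        decode (proj₁ (element σ) ⟨$⟩ʳ encode v)   ≡⟨ cong (λ g → decode (g ⟨$⟩ʳ encode v)) eq ⟩
        decode (proj₁ (element τ) ⟨$⟩ʳ encode v)   ≡⟨ cong decode (element-maps τ v) ⟩
        decode (encode (apply τ v))                ≡⟨ decode∘encode (apply τ v) ⟩
        apply τ v                                  ∎
        where open ≡-Reasoning

    -- Every bit vector indexed by the fibre, used on the side opposite to z, selects a kernel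
    -- symmetry fixing z; the selected bit is read off at the point moved by κ.
    stabiliser-bound : ∀ z → 2 ^ X ≤ stabOrder localGroup z
    stabiliser-bound z = stabOrder-≥ localGroup z (g ∘ bits) (λ t → proj₁ (proj₂ (element (σ (bits t)))) , g-fixes (bits t))
      λ t t' eq → Injection.injective (↔⇒↣ (Vec↔ 2↔Bool X)) (g-injective (bits t) (bits t') eq)
      where
      b = proj₁ (decode z)
      x₀ = proj₁ κ-moves
      bits : Fin (2 ^ X) → Vec Bool X
      bits = Inverse.to (Vec↔ 2↔Bool X)
      σ : Vec Bool X → Symmetry
      σ s = kernel (onSide (not b) λ M → lookup s (Inverse.from Mat↔ M))
      g : Vec Bool X → Permutation′ size
      g s = proj₁ (element (σ s))
      g-fixes : ∀ s → g s ⟨$⟩ʳ z ≡ z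
      g-fixes s = begin
        g s ⟨$⟩ʳ z                        ≡⟨ cong (g s ⟨$⟩ʳ_) (encode∘decode z) ⟨
        g s ⟨$⟩ʳ encode (decode z)        ≡⟨ element-maps (σ s) (decode z) ⟩
        encode (apply (σ s) (decode z))  ≡⟨ cong (λ t → encode (b , κ-if t _ , _)) (onSide-other b _ _) ⟩
        encode (decode z)                ≡⟨ encode∘decode z ⟩
        z                                ∎
        where open ≡-Reasoning
      bit : ∀ s j → proj₁ (proj₂ (apply (σ s) (not b , x₀ , Inverse.to Mat↔ j))) ≡ κ-if (lookup s j) x₀
      bit s j = cong (λ t → κ-if t x₀) (trans (onSide-same b _ _) (cong (lookup s) (Inverse.strictlyInverseʳ Mat↔ j)))
      g-injective : ∀ s s' → g s ≡ g s' → s ≡ s'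
      g-injective s s' g≡ = lookup-injective λ j → κ-if-flag (begin
        κ-if (lookup s j) x₀
          ≡⟨ bit s j ⟨
        proj₁ (proj₂ (apply (σ s) (not b , x₀ , Inverse.to Mat↔ j)))
          ≡⟨ cong (proj₁ ∘ proj₂) (same-element⇒same-apply (σ s) (σ s') g≡ _) ⟩
        proj₁ (proj₂ (apply (σ s') (not b , x₀ , Inverse.to Mat↔ j)))
          ≡⟨ bit s' j ⟩
        κ-if (lookup s' j) x₀ ∎)
        where open ≡-Reasoning

    lifts : ∀ z → Lifts z
    lifts z = let (t , t∈ , tz₀≡z) = moves-base-to z in subst Lifts tz₀≡z (lifts-transport lifts-at-base t∈)

    cover : LPair L
    cover = record
      { size = size
      ; graph = graph
      ; group = localGroup
      ; isLocally = connected , automorphisms , transitive-from localGroup z₀ moves-base-to , λ z → locallyIsoAt z (lifts z) }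

open Blocks using (blockSystem)
open Cover using (module CoverGraph)
open Arithmetic using (exponential-bound)

theorem1p2 : (k : ℕ) (L : PermGroup k) (B : Subset k) →
    Transitive L → IsNontrivialBlock L B → PtStabComplementNontrivial L B →
    ExponentialGraphGrowth L
theorem1p2 zero L B _ _ (_ , _ , _ , () , _)
theorem1p2 (suc k) L B L-transitive nontrivial-block kernel =
  Γ.cover , (λ M → M , λ n M≤n → ≤-trans M≤n (Γ.n≤size n)) ,
  suc (4 * suc k) , 4 * suc k , s≤s z≤n , n<1+n _ ,
  λ n v → exponential-bound k (Γ.X n) _ (Γ.stabiliser-bound n v)
  where
  module Γ n = CoverGraph L L-transitive (blockSystem L B nontrivial-block kernel) n
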